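{- Let $t\ge 2$ and let $K_{n_1,\dots,n_t}$ be a complete multipartite graph with vertex classes $V_1,\dots,V_t$ of sizes $n_1\le n_2\le\dots\le n_t$, where $n_t\ge 3$. Then there is a 1-selection $f$ attaining $\chi_1$ for which some color class of an optimal proper coloring of the 1-removed graph is $V_t\cup\{v_1\}$ with $v_1\in V_1$; that is, $$\chi_1(K_{n_1,\dots,n_t})=1+\chi_1(K_{n_1-1,n_2,\dots,n_{t-1}}).$$ In particular, if $n_1=1$ and $n_t\ge 3$, then $\chi_1(K_{n_1,\dots,n_t})=1+\chi_1(K_{n_2,\dots,n_{t-1}})$.
   Context: $K_{n_1,\dots,n_t}$ denotes the complete $t$-partite graph with vertex classes of sizes $n_1,\dots,n_t$ in which two vertices are adjacent iff they lie in different classes; a class of size 0 is simply omitted, and the graph with no vertices has $\chi_1=0$. A 1-selection of a graph $G=(V,E)$ is a map $f$ assigning to each vertex $v$ a set $f(v)$ of at most one edge incident with $v$. The 1-removed subgraph $G_f$ has vertex set $V$ and edge set $E\setminus\bigcup_{v\in V}f(v)$. The robust chromatic number is $\chi_1(G)=\min_f\chi(G_f)$ over all 1-selections $f$ of $G$. -}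

module Defs where

open import Data.Nat using (ℕ; zero; suc; _≤_)
open import Data.Fin using (Fin; zero; suc; toℕ)
open import Data.List using (List; []; _∷_; length; lookup)
open import Data.Maybe using (Maybe; just; nothing)
open import Data.Product using (Σ; ∃; ∃-syntax; _×_; _,_; proj₁; proj₂)
open import Data.Sum using (_⊎_)
open import Relation.Binary.PropositionalEquality using (_≡_; _≢_)
open import Relation.Nullary using (¬_)

-- The complete multipartite graph K_{n_1,...,n_t} given by the list of class
-- sizes ns = n_1 ∷ ... ∷ n_t.  A class of size 0 contributes no vertices.
record Vertex (ns : List ℕ) : Set where
  constructor vtx
  field
    cls : Fin (length ns)
    pos : Fin (lookup ns cls)
open Vertex public

Adj : {ns : List ℕ} → Vertex ns → Vertex ns → Set
Adj {ns} u v = cls {ns} u ≢ cls v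

-- A 1-selection: each vertex v selects at most one incident edge {v , w},
-- encoded as f v = nothing (no edge) or f v = just w with w a neighbour of v.
record OneSelection (ns : List ℕ) : Set where
  field
    sel   : Vertex ns → Maybe (Vertex ns)
    valid : ∀ v w → sel v ≡ just w → Adj v w
open OneSelection public

Removed : {ns : List ℕ} → OneSelection ns → Vertex ns → Vertex ns → Set
Removed f u w = (sel f u ≡ just w) ⊎ (sel f w ≡ just u)

AdjF : {ns : List ℕ} → OneSelection ns → Vertex ns → Vertex ns → Set
AdjF f u w = Adj u w × ¬ Removed f u w

ProperColoring : {ns : List ℕ} → OneSelection ns → (k : ℕ) → (Vertex ns → Fin k) → Set
ProperColoring f k c = ∀ u w → AdjF f u w → c u ≢ c w

Robust1Colorable : List ℕ → ℕ → Set
Robust1Colorable ns k = Σ (OneSelection ns) (λ f → ∃[ c ] ProperColoring f k c)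

-- χ₁(K_ns) = k, i.e. k = min_f χ(G_f)  (min over pairs (f , colouring))
IsChi1 : List ℕ → ℕ → Set
IsChi1 ns k = Robust1Colorable ns k × (∀ m → Robust1Colorable ns m → k ≤ m)

module Submission where

open import Defs
open import Data.Bool using (Bool; true; false; if_then_else_)
open import Data.Empty using (⊥; ⊥-elim)
open import Data.Fin using (Fin; zero; suc; toℕ; fromℕ<)
open import Data.Fin.Properties using (any?; all?; toℕ-injective; toℕ<n; toℕ-fromℕ<; suc-injective)
  renaming (_≟_ to _≟ᶠ_)
open import Data.List using (List; []; _∷_; _++_; length; lookup)
open import Data.List.Relation.Unary.Linked using (Linked; []; [-]; _∷_)
open import Data.Maybe using (Maybe; just; nothing) renaming (map to mapMaybe)
open import Data.Nat using (ℕ; zero; suc; _+_; _∸_; _⊓_; _⊔_; _≤_; _<_; z≤n; s≤s; _≤?_; _<?_)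
open import Data.Nat.Induction using (<-rec)
open import Data.Nat.Properties hiding (suc-injective)
open import Data.Maybe.Properties using (just-injective)
open import Algebra.Properties.CommutativeMonoid.Sum +-0-commutativeMonoid
  using (sum; ∑-comm; sum-cong-≗; sum-replicate-zero)
open import Data.Product using (Σ; ∃-syntax; _×_; _,_; proj₁; proj₂)
open import Data.Sum using (_⊎_; inj₁; inj₂)
open import Data.Vec.Functional using (updateAt; tail) renaming (_∷_ to _∷ᶜ_)
open import Data.Vec.Functional.Properties using (updateAt-updates; updateAt-minimal)
open import Function using (const; id; _∘_; case_of_)
open import Function.Bundles using (_⇔_; mk⇔; module Equivalence)
open import Relation.Binary.PropositionalEquality
open import Relation.Nullary using (¬_; Dec; yes; no; does)
open import Relation.Nullary.Decidable using (_×-dec_; ¬?)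
open import Relation.Unary using (Decidable)

-- A colour class of G_f is a set of vertices all of whose internal edges are
-- selected, each by one of its ends; as every vertex selects at most one edge,
-- this forces every component of the induced complete multipartite graph to have
-- no more edges than vertices.  Recording only how many vertices of each class
-- it contains, a colour class is thus one part, a star K_{1,k}, a 4-cycle K_{2,2}
-- or a triangle K_{1,1,1}: exactly the count vectors dominating none of the
-- patterns 2+3, 1+1+2 and 1+1+1+1.  Conversely every such shape is realised by a
-- suitable selection, so χ₁(K_n) is the least number of these "admissible"
-- vectors summing to n.
--
-- The theorem then follows from a reduction on such sums: if n is written as a
-- sum of m admissible vectors, q is a largest part with n q ≥ 3 and p is a
-- smallest non-empty part, then n with part q deleted and one vertex removed from
-- p is a sum of m − 1 admissible vectors.  This is proved by induction on m,
-- following the block containing a vertex of p; conversely, adding the star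
-- formed by part q and one vertex of p shows that the bound is attained.

≱1⇒≡0 : ∀ {n} → ¬ (1 ≤ n) → n ≡ 0
≱1⇒≡0 1≰n = n<1⇒n≡0 (≰⇒> 1≰n)

Counts : ℕ → Set
Counts t = Fin t → ℕ

module _ {t : ℕ} where

  infixl 6 _∸ᶜ_ _+ᶜ_
  infix 4 _≤ᶜ_

  _∸ᶜ_ _+ᶜ_ : Counts t → Counts t → Counts t
  (a ∸ᶜ b) i = a i ∸ b i
  (a +ᶜ b) i = a i + b i

  _≤ᶜ_ : Counts t → Counts t → Set
  a ≤ᶜ b = ∀ i → a i ≤ b i

  0ᶜ : Counts t
  0ᶜ = const 0

  set : Counts t → Fin t → ℕ → Counts t
  set v i k = updateAt v i (const k)

  set-≡ : ∀ v i k → set v i k i ≡ k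
  set-≡ v i k = updateAt-updates i v

  set-≢ : ∀ v i k {x} → x ≢ i → set v i k x ≡ v x
  set-≢ v i k {x} = updateAt-minimal x i v

  δ : Fin t → Counts t
  δ a = set 0ᶜ a 1

  δ-≡ : ∀ a → δ a a ≡ 1
  δ-≡ a = set-≡ 0ᶜ a 1

  δ-≢ : ∀ a {y} → y ≢ a → δ a y ≡ 0
  δ-≢ a = set-≢ 0ᶜ a 1

  caseFin : ∀ {ℓ} {P : Set ℓ} (x y : Fin t) → (x ≡ y → P) → (x ≢ y → P) → P
  caseFin x y f g with x ≟ᶠ y
  ... | yes e = f e
  ... | no x≢y = g x≢y

  Has23 Has112 Has1111 : Counts t → Set
  Has23 v = Σ (Fin t) λ i → Σ (Fin t) λ j → i ≢ j × 2 ≤ v i × 3 ≤ v j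
  Has112 v = Σ (Fin t) λ i → Σ (Fin t) λ j → Σ (Fin t) λ k →
    i ≢ j × i ≢ k × j ≢ k × 1 ≤ v i × 1 ≤ v j × 2 ≤ v k
  Has1111 v = Σ (Fin t) λ i → Σ (Fin t) λ j → Σ (Fin t) λ k → Σ (Fin t) λ l →
    (i ≢ j × i ≢ k × i ≢ l × j ≢ k × j ≢ l × k ≢ l) × (1 ≤ v i × 1 ≤ v j × 1 ≤ v k × 1 ≤ v l)

  Admissible : Counts t → Set
  Admissible v = ¬ Has23 v × ¬ Has112 v × ¬ Has1111 v

  admissible-antimono : ∀ {v w} → v ≤ᶜ w → Admissible w → Admissible v
  admissible-antimono {v} {w} v≤w (no23 , no112 , no1111) =
    (λ { (i , j , i≢j , a , b) → no23 (i , j , i≢j , lift a , lift b) }) ,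
    (λ { (i , j , k , d₁ , d₂ , d₃ , a , b , c) →
           no112 (i , j , k , d₁ , d₂ , d₃ , lift a , lift b , lift c) }) ,
    (λ { (i , j , k , l , ds , (a , b , c , d)) →
           no1111 (i , j , k , l , ds , (lift a , lift b , lift c , lift d)) })
    where
    lift : ∀ {r i} → r ≤ v i → r ≤ w i
    lift {i = i} r≤v = ≤-trans r≤v (v≤w i)

  admissible-resp : ∀ {v w} → v ≗ w → Admissible w → Admissible v
  admissible-resp v≗w = admissible-antimono (≤-reflexive ∘ v≗w)

  admissible-0 : Admissible 0ᶜ
  admissible-0 = (λ { (_ , _ , _ , () , _) }) , (λ { (_ , _ , _ , _ , _ , _ , () , _) }) ,
                 (λ { (_ , _ , _ , _ , _ , () , _) })

admissible-reindex : ∀ {s t} (σ : Fin s → Fin t) → (∀ {a b} → σ a ≡ σ b → a ≡ b) →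
  ∀ {v : Counts t} → Admissible v → Admissible (v ∘ σ)
admissible-reindex σ σ-inj (no23 , no112 , no1111) =
  (λ { (i , j , d , a , b) → no23 (σ i , σ j , ↑ d , a , b) }) ,
  (λ { (i , j , k , d₁ , d₂ , d₃ , a , b , c) →
         no112 (σ i , σ j , σ k , ↑ d₁ , ↑ d₂ , ↑ d₃ , a , b , c) }) ,
  (λ { (i , j , k , l , (d₁ , d₂ , d₃ , d₄ , d₅ , d₆) , cs) →
       no1111 (σ i , σ j , σ k , σ l , (↑ d₁ , ↑ d₂ , ↑ d₃ , ↑ d₄ , ↑ d₅ , ↑ d₆) , cs) })
  where
  ↑ : ∀ {a b} → a ≢ b → σ a ≢ σ b
  ↑ a≢b = a≢b ∘ σ-inj

module _ {t : ℕ} where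

  supported₁ : ∀ {v : Counts t} {a} → (∀ x → x ≢ a → v x ≡ 0) → ∀ {x} → 1 ≤ v x → x ≡ a
  supported₁ {a = a} zero-else {x} pos with x ≟ᶠ a
  ... | yes x≡a = x≡a
  ... | no x≢a = ⊥-elim (m<n⇒n≢0 pos (zero-else x x≢a))

  supported₂ : ∀ {v : Counts t} {a b} → (∀ x → x ≢ a → x ≢ b → v x ≡ 0) →
    ∀ {x} → 1 ≤ v x → x ≡ a ⊎ x ≡ b
  supported₂ {a = a} {b} zero-else {x} pos with x ≟ᶠ a | x ≟ᶠ b
  ... | yes x≡a | _ = inj₁ x≡a
  ... | no _ | yes x≡b = inj₂ x≡b
  ... | no x≢a | no x≢b = ⊥-elim (m<n⇒n≢0 pos (zero-else x x≢a x≢b))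

  supported₃ : ∀ {v : Counts t} {a b c} → (∀ x → x ≢ a → x ≢ b → x ≢ c → v x ≡ 0) →
    ∀ {x} → 1 ≤ v x → x ≡ a ⊎ x ≡ b ⊎ x ≡ c
  supported₃ {a = a} {b} {c} zero-else {x} pos with x ≟ᶠ a | x ≟ᶠ b | x ≟ᶠ c
  ... | yes x≡a | _ | _ = inj₁ x≡a
  ... | no _ | yes x≡b | _ = inj₂ (inj₁ x≡b)
  ... | no _ | no _ | yes x≡c = inj₂ (inj₂ x≡c)
  ... | no x≢a | no x≢b | no x≢c = ⊥-elim (m<n⇒n≢0 pos (zero-else x x≢a x≢b x≢c))

  pigeonhole₂ : ∀ {a b x y z : Fin t} → x ≢ y → x ≢ z → y ≢ z →
    x ≡ a ⊎ x ≡ b → y ≡ a ⊎ y ≡ b → z ≡ a ⊎ z ≡ b → ⊥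
  pigeonhole₂ x≢y _ _ (inj₁ refl) (inj₁ refl) _ = x≢y refl
  pigeonhole₂ x≢y _ _ (inj₂ refl) (inj₂ refl) _ = x≢y refl
  pigeonhole₂ _ x≢z _ (inj₁ refl) (inj₂ refl) (inj₁ refl) = x≢z refl
  pigeonhole₂ _ _ y≢z (inj₁ refl) (inj₂ refl) (inj₂ refl) = y≢z refl
  pigeonhole₂ _ _ y≢z (inj₂ refl) (inj₁ refl) (inj₁ refl) = y≢z refl
  pigeonhole₂ _ x≢z _ (inj₂ refl) (inj₁ refl) (inj₂ refl) = x≢z refl

  pigeonhole₃ : ∀ {a b c x y z w : Fin t} → x ≢ y → x ≢ z → x ≢ w → y ≢ z → y ≢ w → z ≢ w →
    x ≡ a ⊎ x ≡ b ⊎ x ≡ c → y ≡ a ⊎ y ≡ b ⊎ y ≡ c → z ≡ a ⊎ z ≡ b ⊎ z ≡ c →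
    w ≡ a ⊎ w ≡ b ⊎ w ≡ c → ⊥
  pigeonhole₃ {a} {b} {c} x≢y x≢z x≢w y≢z y≢w z≢w (inj₁ refl) y∈ z∈ w∈ =
    pigeonhole₂ y≢z y≢w z≢w (drop (≢-sym x≢y) y∈) (drop (≢-sym x≢z) z∈) (drop (≢-sym x≢w) w∈)
    where
    drop : ∀ {u} → u ≢ a → u ≡ a ⊎ u ≡ b ⊎ u ≡ c → u ≡ b ⊎ u ≡ c
    drop u≢a (inj₁ u≡a) = ⊥-elim (u≢a u≡a)
    drop _ (inj₂ u∈) = u∈
  pigeonhole₃ {a} {b} {c} x≢y x≢z x≢w y≢z y≢w z≢w (inj₂ (inj₁ refl)) y∈ z∈ w∈ =
    pigeonhole₂ y≢z y≢w z≢w (drop (≢-sym x≢y) y∈) (drop (≢-sym x≢z) z∈) (drop (≢-sym x≢w) w∈)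
    where
    drop : ∀ {u} → u ≢ b → u ≡ a ⊎ u ≡ b ⊎ u ≡ c → u ≡ a ⊎ u ≡ c
    drop _ (inj₁ u≡a) = inj₁ u≡a
    drop u≢b (inj₂ (inj₁ u≡b)) = ⊥-elim (u≢b u≡b)
    drop _ (inj₂ (inj₂ u≡c)) = inj₂ u≡c
  pigeonhole₃ {a} {b} {c} x≢y x≢z x≢w y≢z y≢w z≢w (inj₂ (inj₂ refl)) y∈ z∈ w∈ =
    pigeonhole₂ y≢z y≢w z≢w (drop (≢-sym x≢y) y∈) (drop (≢-sym x≢z) z∈) (drop (≢-sym x≢w) w∈)
    where
    drop : ∀ {u} → u ≢ c → u ≡ a ⊎ u ≡ b ⊎ u ≡ c → u ≡ a ⊎ u ≡ b
    drop _ (inj₁ u≡a) = inj₁ u≡a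
    drop _ (inj₂ (inj₁ u≡b)) = inj₂ u≡b
    drop u≢c (inj₂ (inj₂ u≡c)) = ⊥-elim (u≢c u≡c)

  admissible-star : ∀ {v : Counts t} a b → v a ≤ 1 → (∀ x → x ≢ a → x ≢ b → v x ≡ 0) → Admissible v
  admissible-star {v} a b va≤1 zero-else =
    (λ { (i , j , i≢j , 2≤vi , 3≤vj) →
           no23 i≢j 2≤vi 3≤vj (supported₂ zero-else (≤-trans (s≤s z≤n) 2≤vi))
                              (supported₂ zero-else (≤-trans (s≤s z≤n) 3≤vj)) }) ,
    (λ { (i , j , k , i≢j , i≢k , j≢k , 1≤vi , 1≤vj , 2≤vk) →
           no112 i≢j i≢k j≢k 2≤vk (supported₂ zero-else 1≤vi) (supported₂ zero-else 1≤vj)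
                                   (supported₂ zero-else (≤-trans (s≤s z≤n) 2≤vk)) }) ,
    (λ { (i , j , k , l , (i≢j , i≢k , _ , j≢k , _ , _) , (1≤vi , 1≤vj , 1≤vk , _)) →
           pigeonhole₂ i≢j i≢k j≢k (supported₂ zero-else 1≤vi) (supported₂ zero-else 1≤vj)
                                   (supported₂ zero-else 1≤vk) })
    where
    no23 : ∀ {i j} → i ≢ j → 2 ≤ v i → 3 ≤ v j → i ≡ a ⊎ i ≡ b → j ≡ a ⊎ j ≡ b → ⊥
    no23 _ 2≤vi _ (inj₁ refl) _ = <⇒≱ 2≤vi va≤1
    no23 _ _ 3≤vj _ (inj₁ refl) = <⇒≱ (≤-trans (s≤s (s≤s z≤n)) 3≤vj) va≤1
    no23 i≢j _ _ (inj₂ refl) (inj₂ refl) = i≢j refl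
    no112 : ∀ {i j k} → i ≢ j → i ≢ k → j ≢ k → 2 ≤ v k →
      i ≡ a ⊎ i ≡ b → j ≡ a ⊎ j ≡ b → k ≡ a ⊎ k ≡ b → ⊥
    no112 _ _ _ 2≤vk _ _ (inj₁ refl) = <⇒≱ 2≤vk va≤1
    no112 i≢j _ _ _ (inj₁ refl) (inj₁ refl) (inj₂ refl) = i≢j refl
    no112 _ i≢k _ _ (inj₂ refl) _ (inj₂ refl) = i≢k refl
    no112 _ _ j≢k _ _ (inj₂ refl) (inj₂ refl) = j≢k refl

  admissible-triangle : ∀ {v : Counts t} a b c → v a ≤ 1 → v b ≤ 1 → v c ≤ 1 →
    (∀ x → x ≢ a → x ≢ b → x ≢ c → v x ≡ 0) → Admissible v
  admissible-triangle {v} a b c va≤1 vb≤1 vc≤1 zero-else =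
    (λ { (i , j , _ , 2≤vi , _) → no2 2≤vi (supported₃ zero-else (≤-trans (s≤s z≤n) 2≤vi)) }) ,
    (λ { (i , j , k , _ , _ , _ , _ , _ , 2≤vk) → no2 2≤vk (supported₃ zero-else (≤-trans (s≤s z≤n) 2≤vk)) }) ,
    (λ { (i , j , k , l , (d₁ , d₂ , d₃ , d₄ , d₅ , d₆) , (1≤vi , 1≤vj , 1≤vk , 1≤vl)) →
           pigeonhole₃ d₁ d₂ d₃ d₄ d₅ d₆ (supported₃ zero-else 1≤vi) (supported₃ zero-else 1≤vj)
                                         (supported₃ zero-else 1≤vk) (supported₃ zero-else 1≤vl) })
    where
    no2 : ∀ {j} → 2 ≤ v j → j ≡ a ⊎ j ≡ b ⊎ j ≡ c → ⊥
    no2 2≤vj (inj₁ refl) = <⇒≱ 2≤vj va≤1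
    no2 2≤vj (inj₂ (inj₁ refl)) = <⇒≱ 2≤vj vb≤1
    no2 2≤vj (inj₂ (inj₂ refl)) = <⇒≱ 2≤vj vc≤1

  data Shape (v : Counts t) : Set where
    empty : (∀ x → v x ≡ 0) → Shape v
    part : ∀ i → (∀ x → x ≢ i → v x ≡ 0) → Shape v
    star : ∀ c l → c ≢ l → v c ≡ 1 → (∀ x → x ≢ c → x ≢ l → v x ≡ 0) → Shape v
    square : ∀ i j → i ≢ j → v i ≡ 2 → v j ≡ 2 → (∀ x → x ≢ i → x ≢ j → v x ≡ 0) → Shape v
    triangle : ∀ i j l → i ≢ j → i ≢ l → j ≢ l → v i ≡ 1 → v j ≡ 1 → v l ≡ 1 →
      (∀ x → x ≢ i → x ≢ j → x ≢ l → v x ≡ 0) → Shape v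

  shape-twoParts : ∀ {v : Counts t} → ¬ Has23 v → ∀ i j → i ≢ j → 1 ≤ v i → 1 ≤ v j →
    (∀ x → x ≢ i → x ≢ j → v x ≡ 0) → Shape v
  shape-twoParts {v} no23 i j i≢j vi vj zero-else with v i ≤? 1 | v j ≤? 1 | v i ≤? 2 | v j ≤? 2
  ... | yes vi≤1 | _ | _ | _ = star i j i≢j (≤-antisym vi≤1 vi) zero-else
  ... | no _ | yes vj≤1 | _ | _ =
    star j i (≢-sym i≢j) (≤-antisym vj≤1 vj) (λ x x≢j x≢i → zero-else x x≢i x≢j)
  ... | no vi≰1 | no vj≰1 | yes vi≤2 | yes vj≤2 =
    square i j i≢j (≤-antisym vi≤2 (≰⇒> vi≰1)) (≤-antisym vj≤2 (≰⇒> vj≰1)) zero-else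
  ... | no _ | no vj≰1 | no vi≰2 | _ = ⊥-elim (no23 (j , i , ≢-sym i≢j , ≰⇒> vj≰1 , ≰⇒> vi≰2))
  ... | no vi≰1 | no _ | _ | no vj≰2 = ⊥-elim (no23 (i , j , i≢j , ≰⇒> vi≰1 , ≰⇒> vj≰2))

  shape-threeParts : ∀ {v : Counts t} → ¬ Has112 v → ∀ i j l → i ≢ j → i ≢ l → j ≢ l →
    1 ≤ v i → 1 ≤ v j → 1 ≤ v l → (∀ x → x ≢ i → x ≢ j → x ≢ l → v x ≡ 0) → Shape v
  shape-threeParts {v} no112 i j l i≢j i≢l j≢l vi vj vl zero-else with v i ≤? 1 | v j ≤? 1 | v l ≤? 1
  ... | yes vi≤1 | yes vj≤1 | yes vl≤1 =
    triangle i j l i≢j i≢l j≢l (≤-antisym vi≤1 vi) (≤-antisym vj≤1 vj) (≤-antisym vl≤1 vl) zero-else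
  ... | no vi≰1 | _ | _ = ⊥-elim (no112 (j , l , i , j≢l , ≢-sym i≢j , ≢-sym i≢l , vj , vl , ≰⇒> vi≰1))
  ... | yes _ | no vj≰1 | _ = ⊥-elim (no112 (i , l , j , i≢l , i≢j , ≢-sym j≢l , vi , vl , ≰⇒> vj≰1))
  ... | yes _ | yes _ | no vl≰1 = ⊥-elim (no112 (i , j , l , i≢j , i≢l , j≢l , vi , vj , ≰⇒> vl≰1))

  shape : ∀ {v : Counts t} → Admissible v → Shape v
  shape {v} (no23 , no112 , no1111) with any? (λ x → 1 ≤? v x)
  ... | no none = empty (λ x → ≱1⇒≡0 (λ pos → none (x , pos)))
  ... | yes (i , vi) with any? (λ x → ¬? (x ≟ᶠ i) ×-dec (1 ≤? v x))
  ...   | no none = part i (λ x x≢i → ≱1⇒≡0 (λ pos → none (x , x≢i , pos)))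
  ...   | yes (j , j≢i , vj)
          with any? (λ x → ¬? (x ≟ᶠ i) ×-dec ¬? (x ≟ᶠ j) ×-dec (1 ≤? v x))
  ...     | no none = shape-twoParts no23 i j (≢-sym j≢i) vi vj
                        (λ x x≢i x≢j → ≱1⇒≡0 (λ pos → none (x , x≢i , x≢j , pos)))
  ...     | yes (l , l≢i , l≢j , vl)
            with any? (λ x → ¬? (x ≟ᶠ i) ×-dec ¬? (x ≟ᶠ j) ×-dec ¬? (x ≟ᶠ l) ×-dec (1 ≤? v x))
  ...       | yes (w , w≢i , w≢j , w≢l , vw) =
                ⊥-elim (no1111 (i , j , l , w , (≢-sym j≢i , ≢-sym l≢i , ≢-sym w≢i , ≢-sym l≢j ,
                                                 ≢-sym w≢j , ≢-sym w≢l) , (vi , vj , vl , vw)))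
  ...       | no none = shape-threeParts no112 i j l (≢-sym j≢i) (≢-sym l≢i) (≢-sym l≢j) vi vj vl
                          (λ x x≢i x≢j x≢l → ≱1⇒≡0 (λ pos → none (x , x≢i , x≢j , x≢l , pos)))

  merge : Fin t → Fin t → Counts t → Counts t
  merge i j v = set (set v j (v i + v j)) i 0

  merge-i : ∀ i j v → merge i j v i ≡ 0
  merge-i i j v = set-≡ _ i 0

  merge-j : ∀ i j v → i ≢ j → merge i j v j ≡ v i + v j
  merge-j i j v i≢j = trans (set-≢ _ i 0 (≢-sym i≢j)) (set-≡ v j _)

  merge-other : ∀ i j v {x} → x ≢ i → x ≢ j → merge i j v x ≡ v x
  merge-other i j v x≢i x≢j = trans (set-≢ _ i 0 x≢i) (set-≢ v j _ x≢j)

  ≤+-cases : ∀ {a b r} → 1 ≤ r → r ≤ a + b → r ≤ b ⊎ r ≤ a ⊎ (1 ≤ a × 1 ≤ b)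
  ≤+-cases {zero} _ r≤b = inj₁ r≤b
  ≤+-cases {suc a} {zero} {r} _ r≤a = inj₂ (inj₁ (subst (r ≤_) (+-identityʳ (suc a)) r≤a))
  ≤+-cases {suc a} {suc b} _ _ = inj₂ (inj₂ (s≤s z≤n , s≤s z≤n))

  -- Merging only pours the vertices of part i into part j, so every pattern in the
  -- merge comes from a pattern in v, possibly using part i in place of part j.
  module Merge (v : Counts t) {i j : Fin t} (i≢j : i ≢ j) where

    private
      w : Counts t
      w = merge i j v

    ≢i : ∀ {x r} → 1 ≤ r → r ≤ w x → x ≢ i
    ≢i 1≤r r≤wx refl = m<n⇒n≢0 (≤-trans 1≤r r≤wx) (merge-i i j v)

    outside : ∀ {x r} → 1 ≤ r → r ≤ w x → x ≢ j → r ≤ v x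
    outside 1≤r r≤wx x≢j = subst (_ ≤_) (merge-other i j v (≢i 1≤r r≤wx) x≢j) r≤wx

    at-j : ∀ {r} → 1 ≤ r → r ≤ w j → r ≤ v j ⊎ r ≤ v i ⊎ (1 ≤ v i × 1 ≤ v j)
    at-j 1≤r r≤wj = ≤+-cases 1≤r (subst (_ ≤_) (merge-j i j v i≢j) r≤wj)

    1≤2 : 1 ≤ 2
    1≤2 = s≤s z≤n

    1≤3 : 1 ≤ 3
    1≤3 = s≤s z≤n

    no23 : ¬ Has23 v → ¬ Has112 v → ¬ Has23 w
    no23 ¬23 ¬112 (a , b , a≢b , 2≤wa , 3≤wb) with a ≟ᶠ j | b ≟ᶠ j
    ... | yes refl | yes refl = a≢b refl
    ... | no a≢j | no b≢j = ¬23 (a , b , a≢b , outside 1≤2 2≤wa a≢j , outside 1≤3 3≤wb b≢j)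
    ... | yes refl | no b≢j with at-j 1≤2 2≤wa
    ...   | inj₁ 2≤vj = ¬23 (j , b , a≢b , 2≤vj , outside 1≤3 3≤wb b≢j)
    ...   | inj₂ (inj₁ 2≤vi) = ¬23 (i , b , ≢-sym (≢i 1≤3 3≤wb) , 2≤vi , outside 1≤3 3≤wb b≢j)
    ...   | inj₂ (inj₂ (1≤vi , 1≤vj)) =
      ¬112 (i , j , b , i≢j , ≢-sym (≢i 1≤3 3≤wb) , a≢b , 1≤vi , 1≤vj ,
            ≤-trans (s≤s (s≤s z≤n)) (outside 1≤3 3≤wb b≢j))
    no23 ¬23 ¬112 (a , b , a≢b , 2≤wa , 3≤wb) | no a≢j | yes refl with at-j 1≤3 3≤wb
    ...   | inj₁ 3≤vj = ¬23 (a , j , a≢b , outside 1≤2 2≤wa a≢j , 3≤vj)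
    ...   | inj₂ (inj₁ 3≤vi) = ¬23 (a , i , ≢i 1≤2 2≤wa , outside 1≤2 2≤wa a≢j , 3≤vi)
    ...   | inj₂ (inj₂ (1≤vi , 1≤vj)) =
      ¬112 (i , j , a , i≢j , ≢-sym (≢i 1≤2 2≤wa) , ≢-sym a≢b , 1≤vi , 1≤vj , outside 1≤2 2≤wa a≢j)

    no112 : ¬ Has112 v → ¬ Has1111 v → ¬ Has112 w
    no112 ¬112 ¬1111 (a , b , k , a≢b , a≢k , b≢k , 1≤wa , 1≤wb , 2≤wk) with k ≟ᶠ j
    ... | yes refl with at-j 1≤2 2≤wk
    ...   | inj₁ 2≤vj =
      ¬112 (a , b , j , a≢b , a≢k , b≢k , outside ≤-refl 1≤wa a≢k , outside ≤-refl 1≤wb b≢k , 2≤vj)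
    ...   | inj₂ (inj₁ 2≤vi) =
      ¬112 (a , b , i , a≢b , ≢i ≤-refl 1≤wa , ≢i ≤-refl 1≤wb ,
            outside ≤-refl 1≤wa a≢k , outside ≤-refl 1≤wb b≢k , 2≤vi)
    ...   | inj₂ (inj₂ (1≤vi , 1≤vj)) =
      ¬1111 (a , b , i , j , (a≢b , ≢i ≤-refl 1≤wa , a≢k , ≢i ≤-refl 1≤wb , b≢k , i≢j) ,
             (outside ≤-refl 1≤wa a≢k , outside ≤-refl 1≤wb b≢k , 1≤vi , 1≤vj))
    no112 ¬112 ¬1111 (a , b , k , a≢b , a≢k , b≢k , 1≤wa , 1≤wb , 2≤wk) | no k≢j
      with a ≟ᶠ j | b ≟ᶠ j
    ...   | yes refl | yes refl = a≢b refl
    ...   | no a≢j | no b≢j =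
      ¬112 (a , b , k , a≢b , a≢k , b≢k ,
            outside ≤-refl 1≤wa a≢j , outside ≤-refl 1≤wb b≢j , outside 1≤2 2≤wk k≢j)
    ...   | yes refl | no b≢j with at-j ≤-refl 1≤wa
    ...     | inj₁ 1≤vj =
      ¬112 (j , b , k , a≢b , a≢k , b≢k , 1≤vj , outside ≤-refl 1≤wb b≢j , outside 1≤2 2≤wk k≢j)
    ...     | inj₂ (inj₁ 1≤vi) =
      ¬112 (i , b , k , ≢-sym (≢i ≤-refl 1≤wb) , ≢-sym (≢i 1≤2 2≤wk) , b≢k ,
            1≤vi , outside ≤-refl 1≤wb b≢j , outside 1≤2 2≤wk k≢j)
    ...     | inj₂ (inj₂ (_ , 1≤vj)) =
      ¬112 (j , b , k , a≢b , a≢k , b≢k , 1≤vj , outside ≤-refl 1≤wb b≢j , outside 1≤2 2≤wk k≢j)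
    no112 ¬112 ¬1111 (a , b , k , a≢b , a≢k , b≢k , 1≤wa , 1≤wb , 2≤wk) | no k≢j | no a≢j | yes refl
      with at-j ≤-refl 1≤wb
    ...     | inj₁ 1≤vj =
      ¬112 (a , j , k , a≢b , a≢k , b≢k , outside ≤-refl 1≤wa a≢j , 1≤vj , outside 1≤2 2≤wk k≢j)
    ...     | inj₂ (inj₁ 1≤vi) =
      ¬112 (a , i , k , ≢i ≤-refl 1≤wa , a≢k , ≢-sym (≢i 1≤2 2≤wk) ,
            outside ≤-refl 1≤wa a≢j , 1≤vi , outside 1≤2 2≤wk k≢j)
    ...     | inj₂ (inj₂ (_ , 1≤vj)) =
      ¬112 (a , j , k , a≢b , a≢k , b≢k , outside ≤-refl 1≤wa a≢j , 1≤vj , outside 1≤2 2≤wk k≢j)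

    Origin : Fin t → Fin t → Set
    Origin x y = y ≡ x ⊎ (x ≡ j × y ≡ i)

    origin : ∀ {x} → 1 ≤ w x → Σ (Fin t) λ y → 1 ≤ v y × Origin x y
    origin {x} 1≤wx with x ≟ᶠ j
    ... | no x≢j = x , outside ≤-refl 1≤wx x≢j , inj₁ refl
    ... | yes refl with at-j ≤-refl 1≤wx
    ...   | inj₁ 1≤vj = j , 1≤vj , inj₁ refl
    ...   | inj₂ (inj₁ 1≤vi) = i , 1≤vi , inj₂ (refl , refl)
    ...   | inj₂ (inj₂ (_ , 1≤vj)) = j , 1≤vj , inj₁ refl

    origin-injective : ∀ {x x′ y y′} → x ≢ x′ → 1 ≤ w x → 1 ≤ w x′ →
      Origin x y → Origin x′ y′ → y ≢ y′
    origin-injective x≢x′ _ _ (inj₁ refl) (inj₁ refl) = x≢x′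
    origin-injective _ wx _ (inj₁ refl) (inj₂ (refl , refl)) = ≢i ≤-refl wx
    origin-injective _ _ wx′ (inj₂ (refl , refl)) (inj₁ refl) = ≢-sym (≢i ≤-refl wx′)
    origin-injective x≢x′ _ _ (inj₂ (refl , refl)) (inj₂ (refl , refl)) _ = x≢x′ refl

    no1111 : ¬ Has1111 v → ¬ Has1111 w
    no1111 ¬1111 (a , b , c , d , (d₁ , d₂ , d₃ , d₄ , d₅ , d₆) , (wa , wb , wc , wd))
      with origin wa | origin wb | origin wc | origin wd
    ... | a′ , va , oa | b′ , vb , ob | c′ , vc , oc | d′ , vd , od =
      ¬1111 (a′ , b′ , c′ , d′ ,
             (origin-injective d₁ wa wb oa ob , origin-injective d₂ wa wc oa oc ,
              origin-injective d₃ wa wd oa od , origin-injective d₄ wb wc ob oc ,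
              origin-injective d₅ wb wd ob od , origin-injective d₆ wc wd oc od) ,
             (va , vb , vc , vd))

  admissible-merge : ∀ {v : Counts t} i j → i ≢ j → Admissible v → Admissible (merge i j v)
  admissible-merge {v} i j i≢j (¬23 , ¬112 , ¬1111) =
    no23 ¬23 ¬112 , no112 ¬112 ¬1111 , no1111 ¬1111
    where open Merge v i≢j

m∸n∸o≡m∸o∸n : ∀ m n o → m ∸ n ∸ o ≡ m ∸ o ∸ n
m∸n∸o≡m∸o∸n m n o = begin
  m ∸ n ∸ o   ≡⟨ ∸-+-assoc m n o ⟩
  m ∸ (n + o) ≡⟨ cong (m ∸_) (+-comm n o) ⟩
  m ∸ (o + n) ≡⟨ ∸-+-assoc m o n ⟨
  m ∸ o ∸ n   ∎
  where open ≡-Reasoning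

o≤m∸n⇒n≤m∸o : ∀ {m n o} → n ≤ m → o ≤ m ∸ n → n ≤ m ∸ o
o≤m∸n⇒n≤m∸o {m} {n} {o} n≤m o≤m∸n = subst (_≤ m ∸ o) (m+n∸n≡m n o) (∸-monoˡ-≤ o n+o≤m)
  where
  n+o≤m : n + o ≤ m
  n+o≤m = subst (n + o ≤_) (trans (+-comm n (m ∸ n)) (m∸n+n≡m n≤m)) (+-monoʳ-≤ n o≤m∸n)

m∸[n⊓m]≤o∸n : ∀ {m o} n → m ≤ o → m ∸ (n ⊓ m) ≤ o ∸ n
m∸[n⊓m]≤o∸n {m} {o} n m≤o = begin
  m ∸ (n ⊓ m)           ≡⟨ ∸-distribˡ-⊓-⊔ m n m ⟩
  (m ∸ n) ⊔ (m ∸ m)     ≡⟨ cong ((m ∸ n) ⊔_) (n∸n≡0 m) ⟩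
  (m ∸ n) ⊔ 0           ≡⟨ ⊔-identityʳ (m ∸ n) ⟩
  m ∸ n                 ≤⟨ ∸-monoˡ-≤ n m≤o ⟩
  o ∸ n                 ∎
  where open ≤-Reasoning

[m+n]∸[o+p]≡[m∸o]+[n∸p] : ∀ {m n o p} → o ≤ m → p ≤ n → (m + n) ∸ (o + p) ≡ (m ∸ o) + (n ∸ p)
[m+n]∸[o+p]≡[m∸o]+[n∸p] {m} z≤n p≤n = +-∸-assoc m p≤n
[m+n]∸[o+p]≡[m∸o]+[n∸p] (s≤s o≤m) p≤n = [m+n]∸[o+p]≡[m∸o]+[n∸p] o≤m p≤n

data Decomposition {t : ℕ} (n : Counts t) : ℕ → Set where
  done : (∀ i → n i ≡ 0) → Decomposition n 0
  block : ∀ {m} (B : Counts t) → B ≤ᶜ n → Admissible B → Decomposition (n ∸ᶜ B) m → Decomposition n (suc m)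

module _ {t : ℕ} where

  decomposition-resp : ∀ {n n′ : Counts t} {m} → n ≗ n′ → Decomposition n m → Decomposition n′ m
  decomposition-resp n≗n′ (done null) = done (λ i → trans (sym (n≗n′ i)) (null i))
  decomposition-resp n≗n′ (block B B≤n adm d) =
    block B (λ i → subst (B i ≤_) (n≗n′ i) (B≤n i)) adm
      (decomposition-resp (λ i → cong (_∸ B i) (n≗n′ i)) d)

  decomposition-shrink : ∀ {n y : Counts t} {m} → y ≤ᶜ n → Decomposition n m → Decomposition y m
  decomposition-shrink y≤n (done null) = done (λ i → n≤0⇒n≡0 (subst (_ ≤_) (null i) (y≤n i)))
  decomposition-shrink {y = y} y≤n (block B _ adm d) =
    block (λ i → B i ⊓ y i) (λ i → m⊓n≤n (B i) (y i)) (admissible-antimono (λ i → m⊓n≤m (B i) (y i)) adm)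
      (decomposition-shrink (λ i → m∸[n⊓m]≤o∸n (B i) (y≤n i)) d)

  decomposition-weaken : ∀ {n : Counts t} {m m′} → m ≤ m′ → Decomposition n m → Decomposition n m′
  decomposition-weaken z≤n (done null) = pad null
    where
    pad : ∀ {n : Counts t} {m} → (∀ i → n i ≡ 0) → Decomposition n m
    pad {m = zero} null = done null
    pad {m = suc m} null = block 0ᶜ (λ _ → z≤n) admissible-0 (pad null)
  decomposition-weaken (s≤s m≤m′) (block B B≤n adm d) = block B B≤n adm (decomposition-weaken m≤m′ d)

  decomposition-extend : ∀ {x : Counts t} {m} (C : Counts t) → Admissible C →
    Decomposition x m → Decomposition (x +ᶜ C) (suc m)
  decomposition-extend {x} C adm d =
    block C (λ i → m≤n+m (C i) (x i)) adm (decomposition-resp (λ i → sym (m+n∸n≡m (x i) (C i))) d)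

  decomposition-nonempty : ∀ {n : Counts t} {m} i → 1 ≤ n i → Decomposition n m → 1 ≤ m
  decomposition-nonempty i pos (done null) = ⊥-elim (m<n⇒n≢0 pos (null i))
  decomposition-nonempty i pos (block _ _ _ _) = s≤s z≤n

  merge-mono : ∀ {a b : Counts t} i j → i ≢ j → a ≤ᶜ b → merge i j a ≤ᶜ merge i j b
  merge-mono {a} {b} i j i≢j a≤b x = caseFin x i
    (λ { refl → ≤-reflexive (trans (merge-i i j a) (sym (merge-i i j b))) })
    (λ x≢i → caseFin x j
      (λ { refl → subst₂ _≤_ (sym (merge-j i j a i≢j)) (sym (merge-j i j b i≢j)) (+-mono-≤ (a≤b i) (a≤b j)) })
      (λ x≢j → subst₂ _≤_ (sym (merge-other i j a x≢i x≢j)) (sym (merge-other i j b x≢i x≢j)) (a≤b x)))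

  merge-∸ : ∀ {a b : Counts t} i j → i ≢ j → b ≤ᶜ a → merge i j a ∸ᶜ merge i j b ≗ merge i j (a ∸ᶜ b)
  merge-∸ {a} {b} i j i≢j b≤a x = caseFin x i
    (λ { refl → trans (cong₂ _∸_ (merge-i i j a) (merge-i i j b)) (sym (merge-i i j (a ∸ᶜ b))) })
    (λ x≢i → caseFin x j
      (λ { refl → trans (cong₂ _∸_ (merge-j i j a i≢j) (merge-j i j b i≢j))
                    (trans ([m+n]∸[o+p]≡[m∸o]+[n∸p] (b≤a i) (b≤a j)) (sym (merge-j i j (a ∸ᶜ b) i≢j))) })
      (λ x≢j → trans (cong₂ _∸_ (merge-other i j a x≢i x≢j) (merge-other i j b x≢i x≢j))
                 (sym (merge-other i j (a ∸ᶜ b) x≢i x≢j))))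

  decomposition-merge : ∀ {n : Counts t} {m} i j → i ≢ j → Decomposition n m → Decomposition (merge i j n) m
  decomposition-merge {n} i j i≢j (done null) = done merged-zero
    where
    merged-zero : ∀ x → merge i j n x ≡ 0
    merged-zero x = caseFin x i (λ { refl → merge-i i j n })
      (λ x≢i → caseFin x j (λ { refl → trans (merge-j i j n i≢j) (cong₂ _+_ (null i) (null j)) })
        (λ x≢j → trans (merge-other i j n x≢i x≢j) (null x)))
  decomposition-merge i j i≢j (block B B≤n adm d) =
    block (merge i j B) (merge-mono i j i≢j B≤n) (admissible-merge i j i≢j adm)
      (decomposition-resp (sym ∘ merge-∸ i j i≢j B≤n) (decomposition-merge i j i≢j d))

  decomposition-pick : ∀ {n : Counts t} {m} p → 1 ≤ n p → Decomposition n m →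
    Σ ℕ λ m′ → m ≡ suc m′ × Σ (Counts t) λ B →
      B ≤ᶜ n × Admissible B × 1 ≤ B p × Decomposition (n ∸ᶜ B) m′
  decomposition-pick p pos (done null) = ⊥-elim (m<n⇒n≢0 pos (null p))
  decomposition-pick {n} {suc m} p pos (block B B≤n adm d) with 1 ≤? B p
  ... | yes 1≤Bp = m , refl , B , B≤n , adm , 1≤Bp , d
  ... | no 1≰Bp with decomposition-pick p (subst (1 ≤_) (sym (cong (n p ∸_) (≱1⇒≡0 1≰Bp))) pos) d
  ...   | m′ , refl , B′ , B′≤n∸B , adm′ , 1≤B′p , d′ =
    suc m′ , refl , B′ , (λ i → ≤-trans (B′≤n∸B i) (m∸n≤m (n i) (B i))) , adm′ , 1≤B′p ,
    block B (λ i → o≤m∸n⇒n≤m∸o (B≤n i) (B′≤n∸B i)) adm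
      (decomposition-resp (λ i → m∸n∸o≡m∸o∸n (n i) (B i) (B′ i)) d′)

decomposition-reindex : ∀ {s t} (σ : Fin s → Fin t) → (∀ {a b} → σ a ≡ σ b → a ≡ b) →
  ∀ {n : Counts t} {m} → Decomposition n m → Decomposition (n ∘ σ) m
decomposition-reindex σ σ-inj (done null) = done (null ∘ σ)
decomposition-reindex σ σ-inj (block B B≤n adm d) =
  block (B ∘ σ) (B≤n ∘ σ) (admissible-reindex σ σ-inj adm) (decomposition-reindex σ σ-inj d)

≤-rewrite : ∀ {a a′ b b′ : ℕ} → a ≡ a′ → b ≡ b′ → a′ ≤ b′ → a ≤ b
≤-rewrite refl refl a′≤b′ = a′≤b′

least : ∀ {P : ℕ → Set} → Decidable P → ∀ {N} → P N → ∃[ k ] P k × (∀ {j} → P j → k ≤ j)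
least {P} P? = <-rec (λ N → P N → ∃[ k ] P k × (∀ {j} → P j → k ≤ j)) search _
  where
  search : ∀ N → (∀ {M} → M < N → P M → ∃[ k ] P k × (∀ {j} → P j → k ≤ j)) → P N →
    ∃[ k ] P k × (∀ {j} → P j → k ≤ j)
  search N below PN with anyUpTo? P? N
  ... | yes (M , M<N , PM) = below M<N PM
  ... | no none = N , PN , λ {j} Pj → ≮⇒≥ (λ j<N → none (j , j<N , Pj))

module _ {t : ℕ} where

  argmin : (f : Fin t → ℕ) {P : Fin t → Set} → Decidable P → ∀ {j₀} → P j₀ →
    Σ (Fin t) λ A → P A × (∀ j → P j → f A ≤ f j)
  argmin f {P} P? {j₀} Pj₀ with least (λ b → any? (λ j → P? j ×-dec (f j ≤? b))) (j₀ , Pj₀ , ≤-refl)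
  ... | _ , (A , PA , fA≤k) , minimal = A , PA , λ j Pj → ≤-trans fA≤k (minimal (j , Pj , ≤-refl))

  reduced : Counts t → Fin t → Fin t → Counts t
  reduced n p q = set (set n p (n p ∸ 1)) q 0

  reduced-q : ∀ n p q → reduced n p q q ≡ 0
  reduced-q n p q = set-≡ _ q 0

  reduced-p : ∀ n p q → p ≢ q → reduced n p q p ≡ n p ∸ 1
  reduced-p n p q p≢q = trans (set-≢ _ q 0 p≢q) (set-≡ n p _)

  reduced-other : ∀ n p q {y} → y ≢ p → y ≢ q → reduced n p q y ≡ n y
  reduced-other n p q y≢p y≢q = trans (set-≢ _ q 0 y≢q) (set-≢ n p _ y≢p)

  reduced-≤ : ∀ n p q → reduced n p q ≤ᶜ n
  reduced-≤ n p q y = caseFin y q (λ { refl → subst (_≤ n y) (sym (reduced-q n p y)) z≤n })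
    (λ y≢q → caseFin y p (λ { refl → ≤-trans (≤-reflexive (reduced-p n y q y≢q)) (m∸n≤m (n y) 1) })
      (λ y≢p → ≤-reflexive (reduced-other n p q y≢p y≢q)))

  swap : Fin t → Fin t → Fin t → Fin t
  swap a b y with y ≟ᶠ a | y ≟ᶠ b
  ... | yes _ | _ = b
  ... | no _ | yes _ = a
  ... | no _ | no _ = y

  swap-a : ∀ a b → swap a b a ≡ b
  swap-a a b with a ≟ᶠ a
  ... | yes _ = refl
  ... | no a≢a = ⊥-elim (a≢a refl)

  swap-b : ∀ a b → a ≢ b → swap a b b ≡ a
  swap-b a b a≢b with b ≟ᶠ a | b ≟ᶠ b
  ... | yes b≡a | _ = ⊥-elim (a≢b (sym b≡a))
  ... | no _ | yes _ = refl
  ... | no _ | no b≢b = ⊥-elim (b≢b refl)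

  swap-other : ∀ a b {y} → y ≢ a → y ≢ b → swap a b y ≡ y
  swap-other a b {y} y≢a y≢b with y ≟ᶠ a | y ≟ᶠ b
  ... | yes y≡a | _ = ⊥-elim (y≢a y≡a)
  ... | no _ | yes y≡b = ⊥-elim (y≢b y≡b)
  ... | no _ | no _ = refl

  swap-involutive : ∀ a b → a ≢ b → ∀ y → swap a b (swap a b y) ≡ y
  swap-involutive a b a≢b y = caseFin y a
    (λ { refl → trans (cong (swap y b) (swap-a y b)) (swap-b y b a≢b) })
    (λ y≢a → caseFin y b
      (λ { refl → trans (cong (swap a y) (swap-b a y a≢b)) (swap-a a y) })
      (λ y≢b → trans (cong (swap a b) (swap-other a b y≢a y≢b)) (swap-other a b y≢a y≢b)))

  swap-injective : ∀ a b → a ≢ b → ∀ {x y} → swap a b x ≡ swap a b y → x ≡ y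
  swap-injective a b a≢b {x} {y} e = begin
    x                     ≡⟨ swap-involutive a b a≢b x ⟨
    swap a b (swap a b x) ≡⟨ cong (swap a b) e ⟩
    swap a b (swap a b y) ≡⟨ swap-involutive a b a≢b y ⟩
    y                     ∎
    where open ≡-Reasoning

  cycle : Fin t → Fin t → Fin t → Fin t → Fin t
  cycle a b c = swap a b ∘ swap a c

  cycle-injective : ∀ a b c → a ≢ b → a ≢ c → ∀ {x y} → cycle a b c x ≡ cycle a b c y → x ≡ y
  cycle-injective a b c a≢b a≢c = swap-injective a c a≢c ∘ swap-injective a b a≢b

  module _ {a b c : Fin t} (a≢b : a ≢ b) (a≢c : a ≢ c) (b≢c : b ≢ c) where

    cycle-a : cycle a b c a ≡ c
    cycle-a = trans (cong (swap a b) (swap-a a c)) (swap-other a b (≢-sym a≢c) (≢-sym b≢c))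

    cycle-b : cycle a b c b ≡ a
    cycle-b = trans (cong (swap a b) (swap-other a c (≢-sym a≢b) b≢c)) (swap-b a b a≢b)

    cycle-c : cycle a b c c ≡ b
    cycle-c = trans (cong (swap a b) (swap-b a c a≢c)) (swap-a a b)

  cycle-other : ∀ a b c {y} → y ≢ a → y ≢ b → y ≢ c → cycle a b c y ≡ y
  cycle-other a b c y≢a y≢b y≢c = trans (cong (swap a b) (swap-other a c y≢a y≢c)) (swap-other a b y≢a y≢b)

m≤m∸1+n : ∀ m {n} → 1 ≤ n → m ≤ m ∸ 1 + n
m≤m∸1+n zero _ = z≤n
m≤m∸1+n (suc m) {suc n} _ = subst (suc m ≤_) (sym (+-suc m n)) (s≤s (m≤m+n m n))

m∸1≤m∸2+n : ∀ m {n} → 1 ≤ n → m ∸ 1 ≤ m ∸ 2 + n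
m∸1≤m∸2+n zero _ = z≤n
m∸1≤m∸2+n (suc m) 1≤n = m≤m∸1+n m 1≤n

m∸n+[n∸1]≡m∸1 : ∀ {m n} → 1 ≤ n → n ≤ m → m ∸ n + (n ∸ 1) ≡ m ∸ 1
m∸n+[n∸1]≡m∸1 {suc m} {suc n} _ (s≤s n≤m) = m∸n+n≡m n≤m

suc[m∸1]≡m : ∀ {m} → 1 ≤ m → suc (m ∸ 1) ≡ m
suc[m∸1]≡m {suc m} _ = refl

module _ {t : ℕ} where

  MinPositive : Counts t → Fin t → Set
  MinPositive n p = ∀ j → 1 ≤ n j → n p ≤ n j

  Largest : Counts t → Fin t → Set
  Largest n q = ∀ j → n j ≤ n q

  -- B meets both p and q, so it is a star, a square or a triangle through p and q,
  -- and the other m blocks, suitably merged and relabelled, already cover the reduction.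
  module SharedBlock {m : ℕ} (n B : Counts t) {p q : Fin t} (p≢q : p ≢ q) (d : Decomposition (n ∸ᶜ B) m) where

    sharing-star-centred-p : B p ≡ 1 → (∀ y → y ≢ p → y ≢ q → B y ≡ 0) → Decomposition (reduced n p q) m
    sharing-star-centred-p Bp≡1 zero-else = decomposition-shrink bound d
      where
      bound : reduced n p q ≤ᶜ n ∸ᶜ B
      bound y = caseFin y q (λ { refl → ≤-rewrite (reduced-q n p q) refl z≤n })
        (λ y≢q → caseFin y p (λ { refl → ≤-rewrite (reduced-p n p q p≢q) (cong (n p ∸_) Bp≡1) ≤-refl })
          (λ y≢p → ≤-rewrite (reduced-other n p q y≢p y≢q) (cong (n y ∸_) (zero-else y y≢p y≢q)) ≤-refl))

    -- The classes p and q trade places, which costs nothing as q is largest.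
    sharing-star-centred-q : Largest n q → B q ≡ 1 → (∀ y → y ≢ p → y ≢ q → B y ≡ 0) →
      Decomposition (reduced n p q) m
    sharing-star-centred-q largest Bq≡1 zero-else =
      decomposition-shrink bound (decomposition-reindex (swap p q) (swap-injective p q p≢q) d)
      where
      bound : ∀ y → reduced n p q y ≤ n (swap p q y) ∸ B (swap p q y)
      bound y = caseFin y q (λ { refl → ≤-rewrite (reduced-q n p q) refl z≤n })
        (λ y≢q → caseFin y p
          (λ { refl → ≤-rewrite (reduced-p n p q p≢q)
                        (trans (cong (λ u → n u ∸ B u) (swap-a p q)) (cong (n q ∸_) Bq≡1))
                        (∸-monoˡ-≤ 1 (largest p)) })
          (λ y≢p → ≤-rewrite (reduced-other n p q y≢p y≢q)
                     (trans (cong (λ u → n u ∸ B u) (swap-other p q y≢p y≢q))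
                       (cong (n y ∸_) (zero-else y y≢p y≢q)))
                     ≤-refl))

    -- What is left of p and q outside B is merged into a single part, which replaces
    -- p: it has n p − 2 + (n q − 2) ≥ n p − 1 vertices.
    sharing-square : 3 ≤ n q → B p ≡ 2 → B q ≡ 2 → (∀ y → y ≢ p → y ≢ q → B y ≡ 0) →
      Decomposition (reduced n p q) m
    sharing-square 3≤nq Bp≡2 Bq≡2 zero-else =
      decomposition-shrink bound
        (decomposition-reindex (swap p q) (swap-injective p q p≢q) (decomposition-merge p q p≢q d))
      where
      x : Counts t
      x = n ∸ᶜ B
      bound : ∀ y → reduced n p q y ≤ merge p q x (swap p q y)
      bound y = caseFin y q (λ { refl → ≤-rewrite (reduced-q n p q) refl z≤n })
        (λ y≢q → caseFin y p
          (λ { refl → ≤-rewrite (reduced-p n p q p≢q)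
                        (trans (cong (merge p q x) (swap-a p q))
                          (trans (merge-j p q x p≢q) (cong₂ _+_ (cong (n p ∸_) Bp≡2) (cong (n q ∸_) Bq≡2))))
                        (m∸1≤m∸2+n (n p) (∸-monoˡ-≤ 2 3≤nq)) })
          (λ y≢p → ≤-rewrite (reduced-other n p q y≢p y≢q)
                     (trans (cong (merge p q x) (swap-other p q y≢p y≢q))
                       (trans (merge-other p q x y≢p y≢q) (cong (n y ∸_) (zero-else y y≢p y≢q))))
                     ≤-refl))

    sharing-triangle : ∀ r → r ≢ p → r ≢ q → 3 ≤ n q → B p ≡ 1 → B q ≡ 1 → B r ≡ 1 →
      (∀ y → y ≢ p → y ≢ q → y ≢ r → B y ≡ 0) → Decomposition (reduced n p q) m
    sharing-triangle r r≢p r≢q 3≤nq Bp≡1 Bq≡1 Br≡1 zero-else =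
      decomposition-shrink bound
        (decomposition-reindex (swap r q) (swap-injective r q r≢q) (decomposition-merge r q r≢q d))
      where
      x : Counts t
      x = n ∸ᶜ B
      bound : ∀ y → reduced n p q y ≤ merge r q x (swap r q y)
      bound y = caseFin y q (λ { refl → ≤-rewrite (reduced-q n p q) refl z≤n })
        (λ y≢q → caseFin y r
          (λ { refl → ≤-rewrite (reduced-other n p q r≢p r≢q)
                        (trans (cong (merge r q x) (swap-a r q))
                          (trans (merge-j r q x r≢q) (cong₂ _+_ (cong (n r ∸_) Br≡1) (cong (n q ∸_) Bq≡1))))
                        (m≤m∸1+n (n r) (≤-trans (s≤s z≤n) (∸-monoˡ-≤ 1 3≤nq))) })
          (λ y≢r → caseFin y p
            (λ { refl → ≤-rewrite (reduced-p n p q p≢q)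
                          (trans (cong (merge r q x) (swap-other r q (≢-sym r≢p) p≢q))
                            (trans (merge-other r q x (≢-sym r≢p) p≢q) (cong (n p ∸_) Bp≡1)))
                          ≤-refl })
            (λ y≢p → ≤-rewrite (reduced-other n p q y≢p y≢q)
                       (trans (cong (merge r q x) (swap-other r q y≢r y≢q))
                         (trans (merge-other r q x y≢r y≢q) (cong (n y ∸_) (zero-else y y≢p y≢q y≢r))))
                       ≤-refl)))

  reduce-sharedBlock : ∀ {m} (n B : Counts t) p q → p ≢ q → Largest n q → 3 ≤ n q → Admissible B →
    1 ≤ B p → 1 ≤ B q → Decomposition (n ∸ᶜ B) m → Decomposition (reduced n p q) m
  reduce-sharedBlock n B p q p≢q largest 3≤nq adm Bp Bq d with shape adm
  ... | empty null = ⊥-elim (m<n⇒n≢0 Bp (null p))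
  ... | part i zero-else = ⊥-elim (p≢q (trans (supported₁ zero-else Bp) (sym (supported₁ zero-else Bq))))
  ... | star c l c≢l Bc≡1 zero-else with supported₂ zero-else Bp | supported₂ zero-else Bq
  ...   | inj₁ refl | inj₁ refl = ⊥-elim (p≢q refl)
  ...   | inj₂ refl | inj₂ refl = ⊥-elim (p≢q refl)
  ...   | inj₁ refl | inj₂ refl = SharedBlock.sharing-star-centred-p n B p≢q d Bc≡1 zero-else
  ...   | inj₂ refl | inj₁ refl =
    SharedBlock.sharing-star-centred-q n B p≢q d largest Bc≡1 (λ y y≢p y≢q → zero-else y y≢q y≢p)
  reduce-sharedBlock n B p q p≢q largest 3≤nq adm Bp Bq d | square i j i≢j Bi≡2 Bj≡2 zero-else
    with supported₂ zero-else Bp | supported₂ zero-else Bq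
  ...   | inj₁ refl | inj₁ refl = ⊥-elim (p≢q refl)
  ...   | inj₂ refl | inj₂ refl = ⊥-elim (p≢q refl)
  ...   | inj₁ refl | inj₂ refl = SharedBlock.sharing-square n B p≢q d 3≤nq Bi≡2 Bj≡2 zero-else
  ...   | inj₂ refl | inj₁ refl =
    SharedBlock.sharing-square n B p≢q d 3≤nq Bj≡2 Bi≡2 (λ y y≢p y≢q → zero-else y y≢q y≢p)
  reduce-sharedBlock n B p q p≢q largest 3≤nq adm Bp Bq d | triangle i j l i≢j i≢l j≢l Bi Bj Bl zero-else
    with supported₃ zero-else Bp | supported₃ zero-else Bq
  ...   | inj₁ refl | inj₁ refl = ⊥-elim (p≢q refl)
  ...   | inj₂ (inj₁ refl) | inj₂ (inj₁ refl) = ⊥-elim (p≢q refl)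
  ...   | inj₂ (inj₂ refl) | inj₂ (inj₂ refl) = ⊥-elim (p≢q refl)
  ...   | inj₁ refl | inj₂ (inj₁ refl) =
    SharedBlock.sharing-triangle n B p≢q d l (≢-sym i≢l) (≢-sym j≢l) 3≤nq Bi Bj Bl zero-else
  ...   | inj₁ refl | inj₂ (inj₂ refl) =
    SharedBlock.sharing-triangle n B p≢q d j (≢-sym i≢j) j≢l 3≤nq Bi Bl Bj (λ y a b c → zero-else y a c b)
  ...   | inj₂ (inj₁ refl) | inj₁ refl =
    SharedBlock.sharing-triangle n B p≢q d l (≢-sym j≢l) (≢-sym i≢l) 3≤nq Bj Bi Bl
      (λ y a b c → zero-else y b a c)
  ...   | inj₂ (inj₁ refl) | inj₂ (inj₂ refl) =
    SharedBlock.sharing-triangle n B p≢q d i i≢j i≢l 3≤nq Bj Bl Bi (λ y a b c → zero-else y c a b)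
  ...   | inj₂ (inj₂ refl) | inj₁ refl =
    SharedBlock.sharing-triangle n B p≢q d j j≢l (≢-sym i≢j) 3≤nq Bl Bi Bj (λ y a b c → zero-else y b c a)
  ...   | inj₂ (inj₂ refl) | inj₂ (inj₁ refl) =
    SharedBlock.sharing-triangle n B p≢q d i i≢l i≢j 3≤nq Bl Bj Bi (λ y a b c → zero-else y c b a)

  Reduction : ℕ → Fin t → Set
  Reduction m q = ∀ (n : Counts t) p → p ≢ q → 1 ≤ n p → MinPositive n p → Largest n q → 3 ≤ n q →
    Decomposition n m → Decomposition (reduced n p q) (m ∸ 1)

  reduce-by-recursion : ∀ {m} (n x : Counts t) p q A → Reduction m q →
    A ≢ q → 1 ≤ x A → MinPositive x A → Largest x q → 3 ≤ x q → Decomposition x m →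
    (C : Counts t) → Admissible C → (σ : Fin t → Fin t) → (∀ {a b} → σ a ≡ σ b → a ≡ b) →
    (∀ y → reduced n p q y ≤ (reduced x A q +ᶜ C) (σ y)) → Decomposition (reduced n p q) m
  reduce-by-recursion {m} n x p q A reduction A≢q 1≤xA minA largest 3≤xq d C adm σ σ-inj bound =
    decomposition-shrink bound
      (decomposition-reindex σ σ-inj
        (subst (Decomposition _) (suc[m∸1]≡m (decomposition-nonempty q (≤-trans (s≤s z≤n) 3≤xq) d))
          (decomposition-extend C adm (reduction x A A≢q 1≤xA minA largest 3≤xq d))))

  exchange : Counts t → Fin t → Fin t → Counts t
  exchange B p A y = B y ∸ δ p y + δ A y

  exchange-p : ∀ B {p A} → A ≢ p → exchange B p A p ≡ B p ∸ 1
  exchange-p B {p} {A} A≢p =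
    trans (cong₂ _+_ (cong (B p ∸_) (δ-≡ p)) (δ-≢ A (≢-sym A≢p))) (+-identityʳ _)

  exchange-A : ∀ B {p A} → A ≢ p → exchange B p A A ≡ B A + 1
  exchange-A B {p} {A} A≢p = cong₂ _+_ (cong (B A ∸_) (δ-≢ p A≢p)) (δ-≡ A)

  exchange-other : ∀ B {p A y} → y ≢ p → y ≢ A → exchange B p A y ≡ B y
  exchange-other B {p} {A} {y} y≢p y≢A =
    trans (cong₂ _+_ (cong (B y ∸_) (δ-≢ p y≢p)) (δ-≢ A y≢A)) (+-identityʳ _)

  exchange-self : ∀ B {p} → 1 ≤ B p → exchange B p p ≗ B
  exchange-self B {p} 1≤Bp y = caseFin y p
    (λ { refl → trans (cong₂ _+_ (cong (B y ∸_) (δ-≡ y)) (δ-≡ y)) (m∸n+n≡m 1≤Bp) })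
    (λ y≢p → exchange-other B y≢p y≢p)

  m+n∸1≤m∸1+n : ∀ {m} n → 1 ≤ m → m + n ∸ 1 ≤ m ∸ 1 + n
  m+n∸1≤m∸1+n {suc m} _ _ = ≤-refl

  m+n≤m∸1+[n+1] : ∀ {m} n → 1 ≤ m → m + n ≤ m ∸ 1 + (n + 1)
  m+n≤m∸1+[n+1] {suc m} n _ = ≤-reflexive (trans (sym (+-suc m n)) (cong (m +_) (+-comm 1 n)))

  -- Moving one vertex of B from p to A: the vertex of A removed by the recursive
  -- reduction of n ∸ B at A comes back inside the block, and p loses one vertex.
  reduced-≤-exchange : ∀ (n B : Counts t) {p q A} → p ≢ q → A ≢ q → B ≤ᶜ n → 1 ≤ B p →
    1 ≤ n A ∸ B A →
    reduced n p q ≤ᶜ reduced (n ∸ᶜ B) A q +ᶜ exchange B p A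
  reduced-≤-exchange n B {p} {q} {A} p≢q A≢q B≤n 1≤Bp 1≤xA y =
    caseFin y q (λ { refl → ≤-rewrite (reduced-q n p q) refl z≤n })
    λ y≢q → caseFin y A
      (λ { refl → caseFin y p
        (λ { refl → ≤-rewrite (reduced-p n y q p≢q)
               (cong₂ _+_ (reduced-p x y q p≢q) (exchange-self B 1≤Bp y))
               (subst (λ k → k ∸ 1 ≤ n y ∸ B y ∸ 1 + B y) (m∸n+n≡m (B≤n y))
                 (m+n∸1≤m∸1+n (B y) 1≤xA)) })
        (λ y≢p → ≤-rewrite (reduced-other n p q y≢p y≢q)
               (cong₂ _+_ (reduced-p x y q A≢q) (exchange-A B y≢p))
               (subst (_≤ n y ∸ B y ∸ 1 + (B y + 1)) (m∸n+n≡m (B≤n y)) (m+n≤m∸1+[n+1] (B y) 1≤xA))) })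
      λ y≢A → caseFin y p
        (λ { refl → ≤-rewrite (reduced-p n y q p≢q)
               (cong₂ _+_ (reduced-other x A q y≢A y≢q) (exchange-p B (≢-sym y≢A)))
               (≤-reflexive (sym (m∸n+[n∸1]≡m∸1 1≤Bp (B≤n y)))) })
        (λ y≢p → ≤-rewrite (reduced-other n p q y≢p y≢q)
               (cong₂ _+_ (reduced-other x A q y≢A y≢q) (exchange-other B y≢p y≢A))
               (≤-reflexive (sym (m∸n+n≡m (B≤n y)))))
    where
    x : Counts t
    x = n ∸ᶜ B

  -- B meets p but not q: n ∸ B is reduced recursively at a smallest non-empty part
  -- A ≠ q, and B is then repaired to cover what this leaves uncovered.
  module DisjointBlock {m : ℕ} (n B : Counts t) {p q : Fin t} (reduction : Reduction m q) (p≢q : p ≢ q)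
    (minp : MinPositive n p) (largest : Largest n q) (3≤nq : 3 ≤ n q) (B≤n : B ≤ᶜ n) (adm : Admissible B)
    (1≤Bp : 1 ≤ B p) (Bq≡0 : B q ≡ 0) (d : Decomposition (n ∸ᶜ B) m) where

    x : Counts t
    x = n ∸ᶜ B

    x≡n : ∀ {y} → B y ≡ 0 → x y ≡ n y
    x≡n {y} By≡0 = cong (n y ∸_) By≡0

    x≤n : ∀ j → x j ≤ n j
    x≤n j = m∸n≤m (n j) (B j)

    largest-x : Largest x q
    largest-x j = ≤-trans (x≤n j) (subst (n j ≤_) (sym (x≡n Bq≡0)) (largest j))

    3≤xq : 3 ≤ x q
    3≤xq = subst (3 ≤_) (sym (x≡n Bq≡0)) 3≤nq

    Candidate : Fin t → Set
    Candidate j = j ≢ q × 1 ≤ x j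

    candidate? : Decidable Candidate
    candidate? j = ¬? (j ≟ᶠ q) ×-dec (1 ≤? x j)

    Chosen : Set
    Chosen = Σ (Fin t) λ A → Candidate A × MinPositive x A

    choose : Σ (Fin t) Candidate → Chosen
    choose (j₀ , c₀) with argmin x candidate? c₀
    ... | A , (A≢q , 1≤xA) , minimal = A , (A≢q , 1≤xA) , minA
      where
      minA : MinPositive x A
      minA j 1≤xj = caseFin j q (λ { refl → largest-x A }) (λ j≢q → minimal j (j≢q , 1≤xj))

    via : ((A , _) : Chosen) → (C : Counts t) → Admissible C →
      (σ : Fin t → Fin t) → (∀ {a b} → σ a ≡ σ b → a ≡ b) →
      (∀ y → reduced n p q y ≤ (reduced x A q +ᶜ C) (σ y)) → Decomposition (reduced n p q) m
    via (A , (A≢q , 1≤xA) , minA) = reduce-by-recursion n x p q A reduction A≢q 1≤xA minA largest-x 3≤xq d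

    via-exchange : ((A , _) : Chosen) → Admissible (exchange B p A) → Decomposition (reduced n p q) m
    via-exchange c@(A , (A≢q , 1≤xA) , _) admC =
      via c (exchange B p A) admC id id (reduced-≤-exchange n B p≢q A≢q B≤n 1≤Bp 1≤xA)

    via-p : 1 ≤ x p → MinPositive x p → Decomposition (reduced n p q) m
    via-p 1≤xp minx = via-exchange (p , (p≢q , 1≤xp) , minx) (admissible-resp (exchange-self B 1≤Bp) adm)

    -- Every vertex outside part q lies in B, so the single block B already covers.
    no-candidate : ¬ Σ (Fin t) Candidate → Decomposition (reduced n p q) m
    no-candidate none =
      decomposition-weaken (decomposition-nonempty q (≤-trans (s≤s z≤n) 3≤xq) d)
        (decomposition-shrink bound (block B (λ _ → ≤-refl) adm (done (λ i → n∸n≡0 (B i)))))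
      where
      bound : reduced n p q ≤ᶜ B
      bound y = caseFin y q (λ { refl → ≤-rewrite (reduced-q n p q) refl z≤n })
        λ y≢q → ≤-trans (reduced-≤ n p q y) (n≤B y≢q)
        where
        n≤B : y ≢ q → n y ≤ B y
        n≤B y≢q with 1 ≤? x y
        ... | yes 1≤xy = ⊥-elim (none (y , y≢q , 1≤xy))
        ... | no 1≰xy = subst (_≤ B y) (m∸n+n≡m (B≤n y)) (≤-reflexive (cong (_+ B y) (≱1⇒≡0 1≰xy)))

    via-exchange-if-admissible : (∀ A → A ≢ p → A ≢ q → Admissible (exchange B p A)) →
      Decomposition (reduced n p q) m
    via-exchange-if-admissible admC with any? candidate?
    ... | no none = no-candidate none
    ... | yes c with choose c
    ...   | A , (A≢q , 1≤xA) , minA = caseFin A p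
      (λ { refl → via-exchange (A , (A≢q , 1≤xA) , minA) (admissible-resp (exchange-self B 1≤Bp) adm) })
      (λ A≢p → via-exchange (A , (A≢q , 1≤xA) , minA) (admC A A≢p A≢q))

    exchange-A≤1 : ∀ {A} → A ≢ p → B A ≡ 0 → exchange B p A A ≤ 1
    exchange-A≤1 A≢p BA≡0 = ≤-reflexive (trans (exchange-A B A≢p) (cong (_+ 1) BA≡0))

    exchange-p≡ : ∀ {A k} → A ≢ p → B p ≡ suc k → exchange B p A p ≡ k
    exchange-p≡ A≢p Bp≡1+k = trans (exchange-p B A≢p) (cong (_∸ 1) Bp≡1+k)

    covered : Fin t → Counts t → Counts t
    covered A C = reduced x A q +ᶜ C

    covered-q : ∀ A C → covered A C q ≡ C q
    covered-q A C = cong (_+ C q) (reduced-q x A q)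

    covered-A : ∀ {A} C → A ≢ q → covered A C A ≡ x A ∸ 1 + C A
    covered-A {A} C A≢q = cong (_+ C A) (reduced-p x A q A≢q)

    covered-other : ∀ {A} C {y} → y ≢ A → y ≢ q → covered A C y ≡ x y + C y
    covered-other {A} C {y} y≢A y≢q = cong (_+ C y) (reduced-other x A q y≢A y≢q)

    covered-untouched : ∀ {A} C {y} → y ≢ A → y ≢ q → C y ≡ 0 → B y ≡ 0 → n y ≤ covered A C y
    covered-untouched C y≢A y≢q Cy≡0 By≡0 =
      ≤-reflexive (sym (trans (covered-other C y≢A y≢q) (trans (cong₂ _+_ (x≡n By≡0) Cy≡0) (+-identityʳ _))))

    covered-inside : ∀ {A} C {y} → y ≢ A → y ≢ q → B y ≤ C y → n y ≤ covered A C y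
    covered-inside C {y} y≢A y≢q By≤Cy = ≤-trans (≤-reflexive (sym (m∸n+n≡m (B≤n y))))
      (≤-trans (+-monoʳ-≤ (x y) By≤Cy) (≤-reflexive (sym (covered-other C y≢A y≢q))))

    starWithQ : Fin t → ℕ → Counts t
    starWithQ c k = set (δ c) q k

    starWithQ-q : ∀ c k → starWithQ c k q ≡ k
    starWithQ-q c k = set-≡ (δ c) q k

    starWithQ-≢q : ∀ c k {y} → y ≢ q → starWithQ c k y ≡ δ c y
    starWithQ-≢q c k = set-≢ (δ c) q k

    admissible-starWithQ : ∀ {c} k → c ≢ q → Admissible (starWithQ c k)
    admissible-starWithQ {c} k c≢q = admissible-star c q (≤-reflexive (trans (starWithQ-≢q c k c≢q) (δ-≡ c)))
      (λ y y≢c y≢q → trans (starWithQ-≢q c k y≢q) (δ-≢ c y≢c))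

    inB⇒≢q : ∀ {y k} → B y ≡ suc k → y ≢ q
    inB⇒≢q By≡1+k refl = 1+n≢0 (trans (sym By≡1+k) Bq≡0)

    case-part : (∀ y → y ≢ p → B y ≡ 0) → Decomposition (reduced n p q) m
    case-part zero-else = via-exchange-if-admissible λ A A≢p A≢q →
      admissible-star A p (exchange-A≤1 A≢p (zero-else A A≢p))
        (λ y y≢A y≢p → trans (exchange-other B y≢p y≢A) (zero-else y y≢p))

    case-star-centre : ∀ l → B p ≡ 1 → (∀ y → y ≢ p → y ≢ l → B y ≡ 0) → Decomposition (reduced n p q) m
    case-star-centre l Bp≡1 zero-else = via-exchange-if-admissible λ A A≢p A≢q → caseFin A l
      (λ { refl → admissible-star p A (≤-rewrite (exchange-p≡ A≢p Bp≡1) refl z≤n)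
                    (λ y y≢p y≢A → trans (exchange-other B y≢p y≢A) (zero-else y y≢p y≢A)) })
      (λ A≢l → admissible-star A l (exchange-A≤1 A≢p (zero-else A A≢p A≢l))
         (λ y y≢A y≢l → caseFin y p (λ { refl → exchange-p≡ (≢-sym y≢A) Bp≡1 })
                          (λ y≢p → trans (exchange-other B y≢p y≢A) (zero-else y y≢p y≢l))))

    case-triangle : ∀ u v → p ≢ u → p ≢ v → u ≢ v → B p ≡ 1 → B u ≡ 1 → B v ≡ 1 →
      (∀ y → y ≢ p → y ≢ u → y ≢ v → B y ≡ 0) → Decomposition (reduced n p q) m
    case-triangle u v p≢u p≢v u≢v Bp≡1 Bu≡1 Bv≡1 zero-else = via-exchange-if-admissible λ A A≢p A≢q →
      let exchange-p-other : ∀ {y} → y ≢ A → (y ≢ p → exchange B p A y ≡ 0) → exchange B p A y ≡ 0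
          exchange-p-other {y} y≢A rest = caseFin y p (λ { refl → exchange-p≡ (≢-sym y≢A) Bp≡1 }) rest
      in caseFin A u
        (λ { refl → admissible-star v A (≤-reflexive (trans (exchange-other B (≢-sym p≢v) (≢-sym u≢v)) Bv≡1))
               (λ y y≢v y≢A → exchange-p-other y≢A λ y≢p →
                  trans (exchange-other B y≢p y≢A) (zero-else y y≢p y≢A y≢v)) })
        λ A≢u → caseFin A v
          (λ { refl → admissible-star u A (≤-reflexive (trans (exchange-other B (≢-sym p≢u) u≢v) Bu≡1))
                 (λ y y≢u y≢A → exchange-p-other y≢A λ y≢p →
                    trans (exchange-other B y≢p y≢A) (zero-else y y≢p y≢u y≢A)) })
          λ A≢v → admissible-triangle u v A
            (≤-reflexive (trans (exchange-other B (≢-sym p≢u) (≢-sym A≢u)) Bu≡1))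
            (≤-reflexive (trans (exchange-other B (≢-sym p≢v) (≢-sym A≢v)) Bv≡1))
            (exchange-A≤1 A≢p (zero-else A A≢p A≢u A≢v))
            (λ y y≢u y≢v y≢A → exchange-p-other y≢A λ y≢p →
               trans (exchange-other B y≢p y≢A) (zero-else y y≢p y≢u y≢v))

    -- When all of part p lies in B the recursion runs at the smallest other
    -- candidate A, and the parts p, q and A may have to be relabelled.
    module Emptied (chosen : Chosen) (xp≡0 : x p ≡ 0) where

      A : Fin t
      A = proj₁ chosen

      A≢q : A ≢ q
      A≢q = proj₁ (proj₁ (proj₂ chosen))

      1≤xA : 1 ≤ x A
      1≤xA = proj₂ (proj₁ (proj₂ chosen))

      A≢p : A ≢ p
      A≢p refl = m<n⇒n≢0 1≤xA xp≡0

      np≡Bp : n p ≡ B p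
      np≡Bp = trans (sym (m∸n+n≡m (B≤n p))) (cong (_+ B p) xp≡0)

      1≤nA : 1 ≤ n A
      1≤nA = ≤-trans 1≤xA (x≤n A)

      np∸1≤nA∸1+0 : n p ∸ 1 ≤ n A ∸ 1 + 0
      np∸1≤nA∸1+0 = subst (n p ∸ 1 ≤_) (sym (+-identityʳ _)) (∸-monoˡ-≤ 1 (minp A 1≤nA))

      -- B a star with centre c and at least three leaves in p: A joins c in place of q.
      star-heavy-leaf : ∀ c → c ≢ p → c ≢ q → B c ≡ 1 → (∀ y → y ≢ c → y ≢ p → B y ≡ 0) →
        Decomposition (reduced n p q) m
      star-heavy-leaf c c≢p c≢q Bc≡1 zero-else =
        via chosen (starWithQ c (n A)) (admissible-starWithQ (n A) c≢q)
          (cycle p q A) (cycle-injective p q A p≢q (≢-sym A≢p)) bound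
        where
        C : Counts t
        C = starWithQ c (n A)
        CA : C A ≡ δ c A
        CA = starWithQ-≢q c (n A) A≢q
        at-p : n p ∸ 1 ≤ x A ∸ 1 + C A
        at-p = caseFin A c
          (λ { refl → ≤-trans (∸-monoˡ-≤ 1 (minp A (≤-trans (≤-reflexive (sym Bc≡1)) (B≤n A))))
                        (≤-rewrite refl (cong₂ _+_ (cong (λ k → n A ∸ k ∸ 1) Bc≡1) (trans CA (δ-≡ A)))
                          (m≤m∸1+n (n A ∸ 1) ≤-refl)) })
          (λ A≢c → ≤-rewrite refl
                     (cong₂ _+_ (cong (_∸ 1) (x≡n (zero-else A A≢c A≢p))) (trans CA (δ-≢ c A≢c)))
                     np∸1≤nA∸1+0)
        bound : ∀ y → reduced n p q y ≤ covered A C (cycle p q A y)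
        bound y = caseFin y q (λ { refl → ≤-rewrite (reduced-q n p y) refl z≤n })
          λ y≢q → caseFin y p
            (λ { refl → ≤-rewrite (reduced-p n y q p≢q)
                   (trans (cong (covered A C) (cycle-a p≢q (≢-sym A≢p) (≢-sym A≢q))) (covered-A C A≢q)) at-p })
          λ y≢p → caseFin y A
            (λ { refl → ≤-rewrite (reduced-other n p q y≢p y≢q)
                   (trans (cong (covered y C) (cycle-c p≢q (≢-sym A≢p) (≢-sym A≢q)))
                     (trans (covered-q y C) (starWithQ-q c (n y))))
                   ≤-refl })
          λ y≢A → ≤-rewrite (reduced-other n p q y≢p y≢q) (cong (covered A C) (cycle-other p q A y≢p y≢q y≢A))
            (covered-inside C y≢A y≢q (subst (B y ≤_) (sym (starWithQ-≢q c (n A) y≢q))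
              (caseFin y c (λ { refl → ≤-rewrite Bc≡1 (δ-≡ y) ≤-refl })
                           (λ y≢c → ≤-rewrite (zero-else y y≢c y≢p) refl z≤n))))

      module _ {j : Fin t} (A≢j : A ≢ j) (p≢j : p ≢ j) (Bp≡2 : B p ≡ 2) (Bj≡2 : B j ≡ 2)
        (zero-else : ∀ y → y ≢ p → y ≢ j → B y ≡ 0) where

        j≢q : j ≢ q
        j≢q = inB⇒≢q Bj≡2

        np≡2 : n p ≡ 2
        np≡2 = trans np≡Bp Bp≡2

        xA≡nA : x A ≡ n A
        xA≡nA = x≡n (zero-else A A≢p A≢j)

        -- The square moves from p to A.
        square-small-A : n A ≤ 2 → Decomposition (reduced n p q) m
        square-small-A nA≤2 = via chosen B adm (swap p A) (swap-injective p A (≢-sym A≢p)) bound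
          where
          bound : ∀ y → reduced n p q y ≤ covered A B (swap p A y)
          bound y = caseFin y q (λ { refl → ≤-rewrite (reduced-q n p y) refl z≤n })
            λ y≢q → caseFin y p
              (λ { refl → ≤-rewrite (reduced-p n y q p≢q) (trans (cong (covered A B) (swap-a y A)) (covered-A B A≢q))
                     (≤-rewrite refl (cong₂ _+_ (cong (_∸ 1) xA≡nA) (zero-else A A≢p A≢j)) np∸1≤nA∸1+0) })
            λ y≢p → caseFin y A
              (λ { refl → ≤-rewrite (reduced-other n p q y≢p y≢q)
                     (trans (cong (covered y B) (swap-b p y (≢-sym A≢p)))
                       (trans (covered-other B (≢-sym y≢p) p≢q) (cong₂ _+_ xp≡0 Bp≡2)))
                     nA≤2 })
            λ y≢A → ≤-rewrite (reduced-other n p q y≢p y≢q) (cong (covered A B) (swap-other p A y≢p y≢A))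
              (covered-inside B y≢A y≢q ≤-refl)

        -- A becomes the centre of a star on part q, j takes the place of q and p the place of j.
        square-large-j : ¬ n A ≤ 2 → ¬ n j ≤ 2 → Decomposition (reduced n p q) m
        square-large-j nA≰2 nj≰2 =
          via chosen C (admissible-starWithQ (n j) A≢q) (cycle p q j) (cycle-injective p q j p≢q p≢j) bound
          where
          C : Counts t
          C = starWithQ A (n j)
          bound : ∀ y → reduced n p q y ≤ covered A C (cycle p q j y)
          bound y = caseFin y q (λ { refl → ≤-rewrite (reduced-q n p y) refl z≤n })
            λ y≢q → caseFin y p
              (λ { refl → ≤-rewrite (trans (reduced-p n y q p≢q) (cong (_∸ 1) np≡2))
                     (trans (cong (covered A C) (cycle-a p≢q p≢j (≢-sym j≢q)))
                       (trans (covered-other C (≢-sym A≢j) j≢q)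
                         (cong₂ _+_ (cong (n j ∸_) Bj≡2)
                           (trans (starWithQ-≢q A (n j) j≢q) (δ-≢ A (≢-sym A≢j))))))
                     (subst (1 ≤_) (sym (+-identityʳ _)) (∸-monoˡ-≤ 2 (≰⇒> nj≰2))) })
            λ y≢p → caseFin y j
              (λ { refl → ≤-rewrite (reduced-other n p q y≢p y≢q)
                     (trans (cong (covered A C) (cycle-c p≢q p≢j (≢-sym j≢q))) (trans (covered-q A C) (starWithQ-q A (n y))))
                     ≤-refl })
            λ y≢j → caseFin y A
              (λ { refl → ≤-rewrite (reduced-other n p q y≢p y≢q)
                     (trans (cong (covered y C) (cycle-other p q j y≢p y≢q y≢j))
                       (trans (covered-A C A≢q)
                         (cong₂ _+_ (cong (_∸ 1) xA≡nA) (trans (starWithQ-≢q A (n j) A≢q) (δ-≡ y)))))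
                     (m≤m∸1+n (n y) ≤-refl) })
            λ y≢A → ≤-rewrite (reduced-other n p q y≢p y≢q) (cong (covered A C) (cycle-other p q j y≢p y≢q y≢j))
              (covered-untouched C y≢A y≢q (trans (starWithQ-≢q A (n j) y≢q) (δ-≢ A y≢A)) (zero-else y y≢p y≢j))

        -- p becomes the centre of a star on part q, A takes the place of q and j the place of A.
        square-large-A : ¬ n A ≤ 2 → n j ≤ 2 → Decomposition (reduced n p q) m
        square-large-A nA≰2 nj≤2 =
          via chosen C (admissible-starWithQ (n A) p≢q) (cycle A j q) (cycle-injective A j q A≢j A≢q) bound
          where
          C : Counts t
          C = starWithQ p (n A)
          bound : ∀ y → reduced n p q y ≤ covered A C (cycle A j q y)
          bound y = caseFin y q (λ { refl → ≤-rewrite (reduced-q n p y) refl z≤n })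
            λ y≢q → caseFin y A
              (λ { refl → ≤-rewrite (reduced-other n p q A≢p y≢q)
                     (trans (cong (covered y C) (cycle-a A≢j A≢q j≢q)) (trans (covered-q y C) (starWithQ-q p (n y))))
                     ≤-refl })
            λ y≢A → caseFin y j
              (λ { refl → ≤-rewrite (reduced-other n p q (≢-sym p≢j) y≢q)
                     (trans (cong (covered A C) (cycle-b A≢j A≢q j≢q))
                       (trans (covered-A C A≢q)
                         (cong₂ _+_ (cong (_∸ 1) xA≡nA) (trans (starWithQ-≢q p (n A) A≢q) (δ-≢ p A≢p)))))
                     (≤-trans nj≤2 (subst (2 ≤_) (sym (+-identityʳ _)) (∸-monoˡ-≤ 1 (≰⇒> nA≰2)))) })
            λ y≢j → caseFin y p
              (λ { refl → ≤-rewrite (trans (reduced-p n y q p≢q) (cong (_∸ 1) np≡2))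
                     (trans (cong (covered A C) (cycle-other A j q (≢-sym A≢p) p≢j p≢q))
                       (trans (covered-other C (≢-sym A≢p) p≢q)
                         (cong₂ _+_ xp≡0 (trans (starWithQ-≢q p (n A) p≢q) (δ-≡ y)))))
                     ≤-refl })
            λ y≢p → ≤-rewrite (reduced-other n p q y≢p y≢q) (cong (covered A C) (cycle-other A j q y≢A y≢j y≢q))
              (covered-untouched C y≢A y≢q (trans (starWithQ-≢q p (n A) y≢q) (δ-≢ p y≢p)) (zero-else y y≢p y≢j))

        square-emptied : Decomposition (reduced n p q) m
        square-emptied with n A ≤? 2 | n j ≤? 2
        ... | yes nA≤2 | _ = square-small-A nA≤2
        ... | no nA≰2 | no nj≰2 = square-large-j nA≰2 nj≰2
        ... | no nA≰2 | yes nj≤2 = square-large-A nA≰2 nj≤2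

    minPositive-x-p : (∀ j → j ≢ p → B j ≤ B p) → MinPositive x p
    minPositive-x-p below-p j 1≤xj = caseFin j p (λ { refl → ≤-refl })
      λ j≢p → ∸-mono (minp j (≤-trans 1≤xj (x≤n j))) (below-p j j≢p)

    via-candidate : (1 ≤ x p → Decomposition (reduced n p q) m) →
      (Chosen → x p ≡ 0 → Decomposition (reduced n p q) m) → Decomposition (reduced n p q) m
    via-candidate nonempty emptied with 1 ≤? x p
    ... | yes 1≤xp = nonempty 1≤xp
    ... | no 1≰xp with any? candidate?
    ...   | no none = no-candidate none
    ...   | yes c = emptied (choose c) (≱1⇒≡0 1≰xp)

    case-star-leaf : ∀ c → c ≢ p → B c ≡ 1 → (∀ y → y ≢ c → y ≢ p → B y ≡ 0) →
      Decomposition (reduced n p q) m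
    case-star-leaf c c≢p Bc≡1 zero-else = via-candidate
      (λ 1≤xp → via-p 1≤xp (minPositive-x-p λ j j≢p →
         caseFin j c (λ { refl → ≤-rewrite Bc≡1 refl 1≤Bp })
                     (λ j≢c → ≤-rewrite (zero-else j j≢c j≢p) refl z≤n)))
      λ chosen xp≡0 → let open Emptied chosen xp≡0 in case B p ≤? 2 of λ where
        (no Bp≰2) → star-heavy-leaf c c≢p (inB⇒≢q Bc≡1) Bc≡1 zero-else
        (yes Bp≤2) → via-exchange chosen (caseFin A c
          (λ { refl → admissible-star p A (≤-rewrite (exchange-p B A≢p) refl (∸-monoˡ-≤ 1 Bp≤2))
                 (λ y y≢p y≢A → trans (exchange-other B y≢p y≢A) (zero-else y y≢A y≢p)) })
          (λ A≢c → admissible-triangle p c A (≤-rewrite (exchange-p B A≢p) refl (∸-monoˡ-≤ 1 Bp≤2))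
                 (≤-reflexive (trans (exchange-other B c≢p (≢-sym A≢c)) Bc≡1))
                 (exchange-A≤1 A≢p (zero-else A A≢c A≢p))
                 (λ y y≢p y≢c y≢A → trans (exchange-other B y≢p y≢A) (zero-else y y≢c y≢p))))

    case-square : ∀ j → p ≢ j → B p ≡ 2 → B j ≡ 2 → (∀ y → y ≢ p → y ≢ j → B y ≡ 0) →
      Decomposition (reduced n p q) m
    case-square j p≢j Bp≡2 Bj≡2 zero-else = via-candidate
      (λ 1≤xp → via-p 1≤xp (minPositive-x-p λ k k≢p →
         caseFin k j (λ { refl → ≤-rewrite Bj≡2 Bp≡2 ≤-refl })
                     (λ k≢j → ≤-rewrite (zero-else k k≢p k≢j) refl z≤n)))
      λ chosen xp≡0 → let open Emptied chosen xp≡0 in caseFin A j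
        (λ { refl → via-exchange chosen (admissible-star p A (≤-reflexive (exchange-p≡ A≢p Bp≡2))
               (λ y y≢p y≢A → trans (exchange-other B y≢p y≢A) (zero-else y y≢p y≢A))) })
        λ A≢j → square-emptied A≢j p≢j Bp≡2 Bj≡2 zero-else

  reduce-disjointBlock : ∀ {m} (n B : Counts t) p q → Reduction m q → p ≢ q → MinPositive n p → Largest n q →
    3 ≤ n q → B ≤ᶜ n → Admissible B → 1 ≤ B p → B q ≡ 0 → Decomposition (n ∸ᶜ B) m →
    Decomposition (reduced n p q) m
  reduce-disjointBlock n B p q reduction p≢q minp largest 3≤nq B≤n adm 1≤Bp Bq≡0 d with shape adm
  ... | empty null = ⊥-elim (m<n⇒n≢0 1≤Bp (null p))
  ... | part i zero-else = case-part (λ y y≢p → zero-else y (λ y≡i → y≢p (trans y≡i (sym (supported₁ zero-else 1≤Bp)))))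
    where open DisjointBlock n B reduction p≢q minp largest 3≤nq B≤n adm 1≤Bp Bq≡0 d
  ... | star c l c≢l Bc≡1 zero-else with supported₂ zero-else 1≤Bp
  ...   | inj₁ refl = case-star-centre l Bc≡1 zero-else
    where open DisjointBlock n B reduction p≢q minp largest 3≤nq B≤n adm 1≤Bp Bq≡0 d
  ...   | inj₂ refl = case-star-leaf c c≢l Bc≡1 zero-else
    where open DisjointBlock n B reduction p≢q minp largest 3≤nq B≤n adm 1≤Bp Bq≡0 d
  reduce-disjointBlock n B p q reduction p≢q minp largest 3≤nq B≤n adm 1≤Bp Bq≡0 d | square i j i≢j Bi Bj zero-else
    with supported₂ zero-else 1≤Bp
  ...   | inj₁ refl = case-square j i≢j Bi Bj zero-else
    where open DisjointBlock n B reduction p≢q minp largest 3≤nq B≤n adm 1≤Bp Bq≡0 d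
  ...   | inj₂ refl = case-square i (≢-sym i≢j) Bj Bi (λ y a b → zero-else y b a)
    where open DisjointBlock n B reduction p≢q minp largest 3≤nq B≤n adm 1≤Bp Bq≡0 d
  reduce-disjointBlock n B p q reduction p≢q minp largest 3≤nq B≤n adm 1≤Bp Bq≡0 d
    | triangle i j l i≢j i≢l j≢l Bi Bj Bl zero-else with supported₃ zero-else 1≤Bp
  ...   | inj₁ refl = case-triangle j l i≢j i≢l j≢l Bi Bj Bl zero-else
    where open DisjointBlock n B reduction p≢q minp largest 3≤nq B≤n adm 1≤Bp Bq≡0 d
  ...   | inj₂ (inj₁ refl) =
    case-triangle i l (≢-sym i≢j) j≢l i≢l Bj Bi Bl (λ y a b c → zero-else y b a c)
    where open DisjointBlock n B reduction p≢q minp largest 3≤nq B≤n adm 1≤Bp Bq≡0 d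
  ...   | inj₂ (inj₂ refl) =
    case-triangle i j (≢-sym i≢l) (≢-sym j≢l) i≢j Bl Bi Bj (λ y a b c → zero-else y b c a)
    where open DisjointBlock n B reduction p≢q minp largest 3≤nq B≤n adm 1≤Bp Bq≡0 d

  decomposition-reduced : ∀ m q → Reduction m q
  decomposition-reduced zero q n p p≢q 1≤np minp largest 3≤nq d =
    ⊥-elim (<-irrefl refl (decomposition-nonempty q (≤-trans (s≤s z≤n) 3≤nq) d))
  decomposition-reduced (suc m) q n p p≢q 1≤np minp largest 3≤nq d with decomposition-pick p 1≤np d
  ... | .m , refl , B , B≤n , adm , 1≤Bp , d′ with 1 ≤? B q
  ...   | yes 1≤Bq = reduce-sharedBlock n B p q p≢q largest 3≤nq adm 1≤Bp 1≤Bq d′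
  ...   | no 1≰Bq = reduce-disjointBlock n B p q (decomposition-reduced m q) p≢q minp largest 3≤nq
                      B≤n adm 1≤Bp (≱1⇒≡0 1≰Bq) d′

record Vertexᶜ {t : ℕ} (n : Counts t) : Set where
  constructor vtxᶜ
  field
    clsᶜ : Fin t
    posᶜ : Fin (n clsᶜ)
open Vertexᶜ public

module _ {t : ℕ} {n : Counts t} where

  vtxᶜ-≡ : ∀ {i} {a b : Fin (n i)} → toℕ a ≡ toℕ b → vtxᶜ {n = n} i a ≡ vtxᶜ i b
  vtxᶜ-≡ e = cong (vtxᶜ _) (toℕ-injective e)

  Removedᶜ : (Vertexᶜ n → Maybe (Vertexᶜ n)) → Vertexᶜ n → Vertexᶜ n → Set
  Removedᶜ select u w = select u ≡ just w ⊎ select w ≡ just u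

record Colouring {t : ℕ} (n : Counts t) (m : ℕ) : Set where
  field
    select : Vertexᶜ n → Maybe (Vertexᶜ n)
    select-valid : ∀ u w → select u ≡ just w → clsᶜ u ≢ clsᶜ w
    colour : Vertexᶜ n → Fin m
    proper : ∀ u w → clsᶜ u ≢ clsᶜ w → ¬ Removedᶜ select u w → colour u ≢ colour w

colouring-empty : ∀ {t} {n : Counts t} → (∀ i → n i ≡ 0) → Colouring n 0
colouring-empty {n = n} null = record
  { select = λ _ → nothing
  ; select-valid = λ _ _ ()
  ; colour = ⊥-elim ∘ no-vertex
  ; proper = λ u → ⊥-elim (no-vertex u)
  }
  where
  no-vertex : Vertexᶜ n → ⊥
  no-vertex (vtxᶜ i a) = m<n⇒n≢0 (toℕ<n a) (null i)

m<n∸o⇒m+o<n : ∀ {m n o} → m < n ∸ o → o ≤ n → m + o < n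
m<n∸o⇒m+o<n {m} {n} {o} m<n∸o o≤n = subst (m + o <_) (m∸n+n≡m o≤n) (+-monoˡ-< o m<n∸o)

<2-cases : ∀ {a b} → a < 2 → b < 2 → a ≡ b ⊎ 1 ∸ b ≡ a
<2-cases {0} {0} _ _ = inj₁ refl
<2-cases {1} {1} _ _ = inj₁ refl
<2-cases {0} {1} _ _ = inj₂ refl
<2-cases {1} {0} _ _ = inj₂ refl
<2-cases {suc (suc _)} (s≤s (s≤s ())) _
<2-cases {0} {suc (suc _)} _ (s≤s (s≤s ()))
<2-cases {1} {suc (suc _)} _ (s≤s (s≤s ()))

-- Colour 0 is given to the first B i vertices of every class i; the remaining
-- vertices are shifted down by B i and coloured by the given colouring of n ∸ B.
module AddBlock {t : ℕ} (n B : Counts t) (B≤n : B ≤ᶜ n) (adm : Admissible B) {m : ℕ}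
  (coloured : Colouring (n ∸ᶜ B) m) where

  open Colouring coloured renaming
    (select to select′; select-valid to select-valid′; colour to colour′; proper to proper′)

  InB : Vertexᶜ n → Set
  InB u = toℕ (posᶜ u) < B (clsᶜ u)

  inB? : Decidable InB
  inB? u = toℕ (posᶜ u) <? B (clsᶜ u)

  unshift : (u : Vertexᶜ n) → ¬ InB u → Vertexᶜ (n ∸ᶜ B)
  unshift (vtxᶜ i ρ) ρ≮Bi = vtxᶜ i (fromℕ< (∸-monoˡ-< (toℕ<n ρ) (≮⇒≥ ρ≮Bi)))

  unshift-cls : ∀ u h → clsᶜ (unshift u h) ≡ clsᶜ u
  unshift-cls (vtxᶜ _ _) _ = refl

  shift : Vertexᶜ (n ∸ᶜ B) → Vertexᶜ n
  shift (vtxᶜ j s) = vtxᶜ j (fromℕ< (m<n∸o⇒m+o<n (toℕ<n s) (B≤n j)))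

  shift-unshift : ∀ u h → shift (unshift u h) ≡ u
  shift-unshift (vtxᶜ i ρ) h =
    vtxᶜ-≡ (trans (toℕ-fromℕ< _) (trans (cong (_+ B i) (toℕ-fromℕ< _)) (m∸n+n≡m (≮⇒≥ h))))

  onlyVertex : ∀ j → B j ≡ 1 → Fin (n j)
  onlyVertex j Bj≡1 = fromℕ< (≤-trans (≤-reflexive (sym Bj≡1)) (B≤n j))

  blockSelect : Shape B → (i : Fin t) → (ρ : Fin (n i)) → toℕ ρ < B i → Maybe (Vertexᶜ n)
  blockSelect (empty _) i ρ h = nothing
  blockSelect (part _ _) i ρ h = nothing
  blockSelect (star c l c≢l Bc≡1 _) i ρ h with i ≟ᶠ l
  ... | yes _ = just (vtxᶜ c (onlyVertex c Bc≡1))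
  ... | no _ = nothing
  blockSelect (square I J I≢J BI≡2 BJ≡2 _) i ρ h with i ≟ᶠ I | i ≟ᶠ J
  ... | yes refl | _ = just (vtxᶜ J (fromℕ< (<-≤-trans h (≤-trans (≤-reflexive (trans BI≡2 (sym BJ≡2))) (B≤n J)))))
  ... | no _ | yes refl = just (vtxᶜ I (fromℕ< (≤-trans (s≤s (m∸n≤m 1 (toℕ ρ))) (subst (_≤ n I) BI≡2 (B≤n I)))))
  ... | no _ | no _ = nothing
  blockSelect (triangle I J L _ _ _ BI≡1 BJ≡1 BL≡1 _) i ρ h with i ≟ᶠ I | i ≟ᶠ J | i ≟ᶠ L
  ... | yes _ | _ | _ = just (vtxᶜ J (onlyVertex J BJ≡1))
  ... | no _ | yes _ | _ = just (vtxᶜ L (onlyVertex L BL≡1))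
  ... | no _ | no _ | yes _ = just (vtxᶜ I (onlyVertex I BI≡1))
  ... | no _ | no _ | no _ = nothing

  record Selects (sh : Shape B) i (ρ : Fin (n i)) (h : toℕ ρ < B i) k (P : ℕ → Set) : Set where
    constructor selecting
    field
      target : Fin (n k)
      property : P (toℕ target)
      selected : blockSelect sh i ρ h ≡ just (vtxᶜ k target)

  selects-star : ∀ {c l c≢l Bc≡1 z} ρ h → Selects (star c l c≢l Bc≡1 z) l ρ h c (_≡ 0)
  selects-star {c} {l} {c≢l} {Bc≡1} {z} ρ h = selecting _ (toℕ-fromℕ< _) selected
    where
    selected : blockSelect (star c l c≢l Bc≡1 z) l ρ h ≡ just (vtxᶜ c (onlyVertex c Bc≡1))
    selected with l ≟ᶠ l
    ... | yes _ = refl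
    ... | no l≢l = ⊥-elim (l≢l refl)

  selects-square-I : ∀ {I J I≢J BI BJ z} ρ h → Selects (square I J I≢J BI BJ z) I ρ h J (_≡ toℕ ρ)
  selects-square-I {I} {J} {I≢J} {BI} {BJ} {z} ρ h = selecting _ (toℕ-fromℕ< _) selected
    where
    selected : blockSelect (square I J I≢J BI BJ z) I ρ h ≡ just (vtxᶜ J _)
    selected with I ≟ᶠ I
    ... | yes refl = refl
    ... | no I≢I = ⊥-elim (I≢I refl)

  selects-square-J : ∀ {I J I≢J BI BJ z} ρ h → Selects (square I J I≢J BI BJ z) J ρ h I (_≡ 1 ∸ toℕ ρ)
  selects-square-J {I} {J} {I≢J} {BI} {BJ} {z} ρ h = selecting _ (toℕ-fromℕ< _) selected
    where
    selected : blockSelect (square I J I≢J BI BJ z) J ρ h ≡ just (vtxᶜ I _)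
    selected with J ≟ᶠ I | J ≟ᶠ J
    ... | yes J≡I | _ = ⊥-elim (I≢J (sym J≡I))
    ... | no _ | yes refl = refl
    ... | no _ | no J≢J = ⊥-elim (J≢J refl)

  module _ {I J L : Fin t} {I≢J : I ≢ J} {I≢L : I ≢ L} {J≢L : J ≢ L} {BI≡1 : B I ≡ 1} {BJ≡1 : B J ≡ 1}
    {BL≡1 : B L ≡ 1} {z : ∀ x → x ≢ I → x ≢ J → x ≢ L → B x ≡ 0} where

    private
      T : Shape B
      T = triangle I J L I≢J I≢L J≢L BI≡1 BJ≡1 BL≡1 z

    selects-triangle-I : ∀ ρ h → Selects T I ρ h J (_≡ 0)
    selects-triangle-I ρ h = selecting _ (toℕ-fromℕ< _) selected
      where
      selected : blockSelect T I ρ h ≡ just (vtxᶜ J (onlyVertex J BJ≡1))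
      selected with I ≟ᶠ I
      ... | yes _ = refl
      ... | no I≢I = ⊥-elim (I≢I refl)

    selects-triangle-J : ∀ ρ h → Selects T J ρ h L (_≡ 0)
    selects-triangle-J ρ h = selecting _ (toℕ-fromℕ< _) selected
      where
      selected : blockSelect T J ρ h ≡ just (vtxᶜ L (onlyVertex L BL≡1))
      selected with J ≟ᶠ I | J ≟ᶠ J
      ... | yes J≡I | _ = ⊥-elim (I≢J (sym J≡I))
      ... | no _ | yes _ = refl
      ... | no _ | no J≢J = ⊥-elim (J≢J refl)

    selects-triangle-L : ∀ ρ h → Selects T L ρ h I (_≡ 0)
    selects-triangle-L ρ h = selecting _ (toℕ-fromℕ< _) selected
      where
      selected : blockSelect T L ρ h ≡ just (vtxᶜ I (onlyVertex I BI≡1))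
      selected with L ≟ᶠ I | L ≟ᶠ J | L ≟ᶠ L
      ... | yes L≡I | _ | _ = ⊥-elim (I≢L (sym L≡I))
      ... | no _ | yes L≡J | _ = ⊥-elim (J≢L (sym L≡J))
      ... | no _ | no _ | yes _ = refl
      ... | no _ | no _ | no L≢L = ⊥-elim (L≢L refl)

  blockSelect-valid : ∀ sh i ρ h w → blockSelect sh i ρ h ≡ just w → i ≢ clsᶜ w
  blockSelect-valid (empty _) i ρ h w ()
  blockSelect-valid (part _ _) i ρ h w ()
  blockSelect-valid (star c l c≢l _ _) i ρ h w e with i ≟ᶠ l
  blockSelect-valid (star c l c≢l _ _) i ρ h w refl | yes refl = ≢-sym c≢l
  blockSelect-valid (star c l c≢l _ _) i ρ h w () | no _
  blockSelect-valid (square I J I≢J _ _ _) i ρ h w e with i ≟ᶠ I | i ≟ᶠ J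
  blockSelect-valid (square I J I≢J _ _ _) i ρ h w refl | yes refl | _ = I≢J
  blockSelect-valid (square I J I≢J _ _ _) i ρ h w refl | no _ | yes refl = ≢-sym I≢J
  blockSelect-valid (square I J I≢J _ _ _) i ρ h w () | no _ | no _
  blockSelect-valid (triangle I J L I≢J I≢L J≢L _ _ _ _) i ρ h w e with i ≟ᶠ I | i ≟ᶠ J | i ≟ᶠ L
  blockSelect-valid (triangle I J L I≢J I≢L J≢L _ _ _ _) i ρ h w refl | yes refl | _ | _ = I≢J
  blockSelect-valid (triangle I J L I≢J I≢L J≢L _ _ _ _) i ρ h w refl | no _ | yes refl | _ = J≢L
  blockSelect-valid (triangle I J L I≢J I≢L J≢L _ _ _ _) i ρ h w refl | no _ | no _ | yes refl = ≢-sym I≢L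
  blockSelect-valid (triangle I J L I≢J I≢L J≢L _ _ _ _) i ρ h w () | no _ | no _ | no _

  selects⇒≡ : ∀ {sh i ρ h k P} {b : Fin (n k)} → (∀ r → P r → r ≡ toℕ b) →
    Selects sh i ρ h k P → blockSelect sh i ρ h ≡ just (vtxᶜ k b)
  selects⇒≡ P⇒≡ (selecting _ Ps e) = trans e (cong just (vtxᶜ-≡ (P⇒≡ _ Ps)))

  unique-position : ∀ {j} {b : Fin (n j)} → toℕ b < B j → B j ≡ 1 → ∀ r → r ≡ 0 → r ≡ toℕ b
  unique-position b<Bj Bj≡1 _ r≡0 = trans r≡0 (sym (n<1⇒n≡0 (subst (_ <_) Bj≡1 b<Bj)))

  block-removes : ∀ sh i k (ρ : Fin (n i)) (σ : Fin (n k)) hu hw → i ≢ k →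
    blockSelect sh i ρ hu ≡ just (vtxᶜ k σ) ⊎ blockSelect sh k σ hw ≡ just (vtxᶜ i ρ)
  block-removes (empty null) i k ρ σ hu hw i≢k = ⊥-elim (m<n⇒n≢0 (≤-trans (s≤s z≤n) hu) (null i))
  block-removes (part I zero-else) i k ρ σ hu hw i≢k =
    ⊥-elim (i≢k (trans (supported₁ zero-else (≤-trans (s≤s z≤n) hu))
                       (sym (supported₁ zero-else (≤-trans (s≤s z≤n) hw)))))
  block-removes sh@(star c l c≢l Bc≡1 zero-else) i k ρ σ hu hw i≢k
    with supported₂ zero-else (≤-trans (s≤s z≤n) hu) | supported₂ zero-else (≤-trans (s≤s z≤n) hw)
  ... | inj₁ refl | inj₁ refl = ⊥-elim (i≢k refl)
  ... | inj₂ refl | inj₂ refl = ⊥-elim (i≢k refl)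
  ... | inj₁ refl | inj₂ refl = inj₂ (selects⇒≡ {sh = sh} (unique-position hu Bc≡1) (selects-star σ hw))
  ... | inj₂ refl | inj₁ refl = inj₁ (selects⇒≡ {sh = sh} (unique-position hw Bc≡1) (selects-star ρ hu))
  block-removes sh@(square I J I≢J BI≡2 BJ≡2 zero-else) i k ρ σ hu hw i≢k
    with supported₂ zero-else (≤-trans (s≤s z≤n) hu) | supported₂ zero-else (≤-trans (s≤s z≤n) hw)
  ... | inj₁ refl | inj₁ refl = ⊥-elim (i≢k refl)
  ... | inj₂ refl | inj₂ refl = ⊥-elim (i≢k refl)
  ... | inj₁ refl | inj₂ refl with <2-cases (subst (_ <_) BI≡2 hu) (subst (_ <_) BJ≡2 hw)
  ...   | inj₁ ρ≡σ = inj₁ (selects⇒≡ {sh = sh} (λ _ r≡ρ → trans r≡ρ ρ≡σ) (selects-square-I ρ hu))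
  ...   | inj₂ 1∸σ≡ρ = inj₂ (selects⇒≡ {sh = sh} (λ _ r≡ → trans r≡ 1∸σ≡ρ) (selects-square-J σ hw))
  block-removes sh@(square I J I≢J BI≡2 BJ≡2 zero-else) i k ρ σ hu hw i≢k | inj₂ refl | inj₁ refl
    with <2-cases (subst (_ <_) BI≡2 hw) (subst (_ <_) BJ≡2 hu)
  ...   | inj₁ σ≡ρ = inj₂ (selects⇒≡ {sh = sh} (λ _ r≡σ → trans r≡σ σ≡ρ) (selects-square-I σ hw))
  ...   | inj₂ 1∸ρ≡σ = inj₁ (selects⇒≡ {sh = sh} (λ _ r≡ → trans r≡ 1∸ρ≡σ) (selects-square-J ρ hu))
  block-removes sh@(triangle I J L I≢J I≢L J≢L BI≡1 BJ≡1 BL≡1 zero-else) i k ρ σ hu hw i≢k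
    with supported₃ zero-else (≤-trans (s≤s z≤n) hu) | supported₃ zero-else (≤-trans (s≤s z≤n) hw)
  ... | inj₁ refl | inj₁ refl = ⊥-elim (i≢k refl)
  ... | inj₂ (inj₁ refl) | inj₂ (inj₁ refl) = ⊥-elim (i≢k refl)
  ... | inj₂ (inj₂ refl) | inj₂ (inj₂ refl) = ⊥-elim (i≢k refl)
  ... | inj₁ refl | inj₂ (inj₁ refl) = inj₁ (selects⇒≡ {sh = sh} (unique-position hw BJ≡1) (selects-triangle-I ρ hu))
  ... | inj₂ (inj₁ refl) | inj₁ refl = inj₂ (selects⇒≡ {sh = sh} (unique-position hu BJ≡1) (selects-triangle-I σ hw))
  ... | inj₂ (inj₁ refl) | inj₂ (inj₂ refl) = inj₁ (selects⇒≡ {sh = sh} (unique-position hw BL≡1) (selects-triangle-J ρ hu))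
  ... | inj₂ (inj₂ refl) | inj₂ (inj₁ refl) = inj₂ (selects⇒≡ {sh = sh} (unique-position hu BL≡1) (selects-triangle-J σ hw))
  ... | inj₂ (inj₂ refl) | inj₁ refl = inj₁ (selects⇒≡ {sh = sh} (unique-position hw BI≡1) (selects-triangle-L ρ hu))
  ... | inj₁ refl | inj₂ (inj₂ refl) = inj₂ (selects⇒≡ {sh = sh} (unique-position hu BI≡1) (selects-triangle-L σ hw))

  select : Vertexᶜ n → Maybe (Vertexᶜ n)
  select u with inB? u
  ... | yes h = blockSelect (shape adm) (clsᶜ u) (posᶜ u) h
  ... | no h = mapMaybe shift (select′ (unshift u h))

  colour : Vertexᶜ n → Fin (suc m)
  colour u with inB? u
  ... | yes _ = zero
  ... | no h = suc (colour′ (unshift u h))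

  select-valid : ∀ u w → select u ≡ just w → clsᶜ u ≢ clsᶜ w
  select-valid u w e with inB? u
  ... | yes h = blockSelect-valid (shape adm) (clsᶜ u) (posᶜ u) h w e
  select-valid (vtxᶜ i ρ) w e | no h with select′ (unshift (vtxᶜ i ρ) h) in selected
  select-valid (vtxᶜ i ρ) w refl | no h | just w′ = select-valid′ _ w′ selected
  select-valid (vtxᶜ i ρ) w () | no h | nothing

  proper : ∀ u w → clsᶜ u ≢ clsᶜ w → ¬ Removedᶜ select u w → colour u ≢ colour w
  proper u w cu≢cw not-removed same with inB? u | inB? w
  ... | yes hu | yes hw with block-removes (shape adm) (clsᶜ u) (clsᶜ w) (posᶜ u) (posᶜ w) hu hw cu≢cw
  ...   | removed = not-removed removed
  proper u w cu≢cw not-removed () | yes hu | no hw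
  proper u w cu≢cw not-removed () | no hu | yes hw
  proper u w cu≢cw not-removed same | no hu | no hw =
    proper′ (unshift u hu) (unshift w hw) (cls-unshift cu≢cw) not-removed′ (suc-injective same)
    where
    cls-unshift : clsᶜ u ≢ clsᶜ w → clsᶜ (unshift u hu) ≢ clsᶜ (unshift w hw)
    cls-unshift cu≢cw e = cu≢cw (trans (sym (unshift-cls u hu)) (trans e (unshift-cls w hw)))
    not-removed′ : ¬ Removedᶜ select′ (unshift u hu) (unshift w hw)
    not-removed′ (inj₁ e) = not-removed (inj₁ (trans (cong (mapMaybe shift) e) (cong just (shift-unshift w hw))))
    not-removed′ (inj₂ e) = not-removed (inj₂ (trans (cong (mapMaybe shift) e) (cong just (shift-unshift u hu))))

  colouring : Colouring n (suc m)
  colouring = record { select = select ; select-valid = select-valid ; colour = colour ; proper = proper }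

  colour≡0⇔InB : ∀ u → (colour u ≡ zero) ⇔ InB u
  colour≡0⇔InB u = mk⇔ to from
    where
    to : colour u ≡ zero → InB u
    to e with inB? u
    ... | yes h = h
    to () | no _
    from : InB u → colour u ≡ zero
    from h with inB? u
    ... | yes _ = refl
    ... | no h′ = ⊥-elim (h′ h)

colouring-from-decomposition : ∀ {t} {n : Counts t} {m} → Decomposition n m → Colouring n m
colouring-from-decomposition (done null) = colouring-empty null
colouring-from-decomposition (block B B≤n adm d) = AddBlock.colouring _ B B≤n adm (colouring-from-decomposition d)

count : ∀ {N} → (Fin N → Bool) → ℕ
count f = sum (λ r → if f r then 1 else 0)

count≥1⇒witness : ∀ {N} (f : Fin N → Bool) → 1 ≤ count f → Σ (Fin N) λ r → f r ≡ true
count≥1⇒witness {suc N} f h with f zero in e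
... | true = zero , e
... | false with count≥1⇒witness (f ∘ suc) h
...   | r , fr = suc r , fr

count≥2⇒witnesses : ∀ {N} (f : Fin N → Bool) → 2 ≤ count f →
  Σ (Fin N) λ r → Σ (Fin N) λ s → r ≢ s × f r ≡ true × f s ≡ true
count≥2⇒witnesses {suc N} f h with f zero in e
... | true with count≥1⇒witness (f ∘ suc) (≤-pred h)
...   | r , fr = zero , suc r , (λ ()) , e , fr
count≥2⇒witnesses {suc N} f h | false with count≥2⇒witnesses (f ∘ suc) h
...   | r , s , r≢s , fr , fs = suc r , suc s , r≢s ∘ suc-injective , fr , fs

count≥3⇒witnesses : ∀ {N} (f : Fin N → Bool) → 3 ≤ count f →
  Σ (Fin N) λ r → Σ (Fin N) λ s → Σ (Fin N) λ u → r ≢ s × r ≢ u × s ≢ u × f r ≡ true × f s ≡ true × f u ≡ true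
count≥3⇒witnesses {suc N} f h with f zero in e
... | true with count≥2⇒witnesses (f ∘ suc) (≤-pred h)
...   | r , s , r≢s , fr , fs = zero , suc r , suc s , (λ ()) , (λ ()) , r≢s ∘ suc-injective , e , fr , fs
count≥3⇒witnesses {suc N} f h | false with count≥3⇒witnesses (f ∘ suc) h
...   | r , s , u , r≢s , r≢u , s≢u , fr , fs , fu =
  suc r , suc s , suc u , r≢s ∘ suc-injective , r≢u ∘ suc-injective , s≢u ∘ suc-injective , fr , fs , fu

sum-1 : ∀ N → sum {N} (const 1) ≡ N
sum-1 zero = refl
sum-1 (suc N) = cong suc (sum-1 N)

sum-indicator : ∀ {m} (x : Fin m) → sum (λ α → if does (x ≟ᶠ α) then 1 else 0) ≡ 1
sum-indicator {suc m} zero = cong suc (sum-replicate-zero m)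
sum-indicator {suc m} (suc x) = sum-indicator {m} x

sum-count : ∀ {N m} (g : Fin N → Fin m) → sum (λ α → count (λ ρ → does (g ρ ≟ᶠ α))) ≡ N
sum-count {N} {m} g = begin
  sum (λ α → sum (λ ρ → indicator ρ α)) ≡⟨ ∑-comm (λ α ρ → indicator ρ α) ⟩
  sum (λ ρ → sum (λ α → indicator ρ α)) ≡⟨ sum-cong-≗ (λ ρ → sum-indicator (g ρ)) ⟩
  sum {N} (const 1)                     ≡⟨ sum-1 N ⟩
  N                                     ∎
  where
  open ≡-Reasoning
  indicator : Fin N → Fin m → ℕ
  indicator ρ α = if does (g ρ ≟ᶠ α) then 1 else 0

decomposition-from-sum : ∀ {t m} (n : Counts t) (f : Fin m → Counts t) → (∀ α → Admissible (f α)) →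
  (∀ i → n i ≡ sum (λ α → f α i)) → Decomposition n m
decomposition-from-sum {m = zero} n f adm n≡ = done n≡
decomposition-from-sum {m = suc m} n f adm n≡ =
  block (f zero) (λ i → subst (f zero i ≤_) (sym (n≡ i)) (m≤m+n _ _)) (adm zero)
    (decomposition-from-sum (n ∸ᶜ f zero) (f ∘ suc) (adm ∘ suc)
      (λ i → trans (cong (_∸ f zero i) (n≡ i)) (m+n∸m≡n (f zero i) _)))

-- Every argument here ends in ⊥, so it is enough to know that the edge between two
-- vertices of the same colour is doubly-negatively removed; no decidability is needed.
module ColourClasses {t : ℕ} {n : Counts t} {m : ℕ} (coloured : Colouring n m) where

  open Colouring coloured

  removed : ∀ u w → clsᶜ u ≢ clsᶜ w → colour u ≡ colour w → ¬ ¬ Removedᶜ select u w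
  removed u w cu≢cw same not-removed = proper u w cu≢cw not-removed same

  selects-once : ∀ {x d d′} → select x ≡ just d → select x ≡ just d′ → d ≡ d′
  selects-once e e′ = just-injective (trans (sym e) e′)

  SelectedBy : Vertexᶜ n → Vertexᶜ n → Vertexᶜ n → Set
  SelectedBy x y d = select x ≡ just d ⊎ select y ≡ just d

  -- d has an edge to both x and y, but can select only one of them.
  selected-by-one : ∀ x y d → x ≢ y → clsᶜ x ≢ clsᶜ d → clsᶜ y ≢ clsᶜ d →
    colour x ≡ colour d → colour y ≡ colour d → ¬ ¬ SelectedBy x y d
  selected-by-one x y d x≢y x≁d y≁d cx cy k = removed x d x≁d cx λ where
    (inj₁ x→d) → k (inj₁ x→d)
    (inj₂ d→x) → removed y d y≁d cy λ where
      (inj₁ y→d) → k (inj₂ y→d)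
      (inj₂ d→y) → x≢y (selects-once d→x d→y)

  no-common-target : ∀ x y d → clsᶜ x ≢ clsᶜ y → colour x ≡ colour y →
    select x ≡ just d → select y ≡ just d → clsᶜ d ≢ clsᶜ x → clsᶜ d ≢ clsᶜ y → ⊥
  no-common-target x y d x≁y same x→d y→d d≁x d≁y = removed x y x≁y same λ where
    (inj₁ x→y) → d≁y (cong clsᶜ (selects-once x→d x→y))
    (inj₂ y→x) → d≁x (cong clsᶜ (selects-once y→d y→x))

  classCounts : Fin m → Counts t
  classCounts α i = count (λ ρ → does (colour (vtxᶜ i ρ) ≟ᶠ α))

  coloured-α : ∀ {α} x → does (colour x ≟ᶠ α) ≡ true → colour x ≡ α
  coloured-α {α} x e with colour x ≟ᶠ α
  ... | yes cx≡α = cx≡α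
  coloured-α x () | no _

  vtxᶜ-≢ : ∀ {i} {ρ σ : Fin (n i)} → ρ ≢ σ → vtxᶜ {n = n} i ρ ≢ vtxᶜ i σ
  vtxᶜ-≢ ρ≢σ refl = ρ≢σ refl

  no23 : ∀ α → ¬ Has23 (classCounts α)
  no23 α (i , j , i≢j , 2≤ , 3≤) with count≥2⇒witnesses _ 2≤ | count≥3⇒witnesses _ 3≤
  ... | r₁ , r₂ , r₁≢r₂ , e₁ , e₂ | s₁ , s₂ , s₃ , s₁≢s₂ , s₁≢s₃ , s₂≢s₃ , f₁ , f₂ , f₃ =
    by-selector s₁ f₁ λ c₁ → by-selector s₂ f₂ λ c₂ → by-selector s₃ f₃ λ c₃ → pigeon c₁ c₂ c₃
    where
    a₁ a₂ : Vertexᶜ n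
    a₁ = vtxᶜ i r₁
    a₂ = vtxᶜ i r₂
    by-selector : ∀ s → does (colour (vtxᶜ j s) ≟ᶠ α) ≡ true → ¬ ¬ SelectedBy a₁ a₂ (vtxᶜ j s)
    by-selector s f = selected-by-one a₁ a₂ (vtxᶜ j s) (vtxᶜ-≢ r₁≢r₂) i≢j i≢j
      (trans (coloured-α a₁ e₁) (sym (coloured-α _ f))) (trans (coloured-α a₂ e₂) (sym (coloured-α _ f)))
    twice : ∀ {s s′} → s ≢ s′ → ∀ {x} → select x ≡ just (vtxᶜ j s) → select x ≡ just (vtxᶜ j s′) → ⊥
    twice s≢s′ e e′ = vtxᶜ-≢ s≢s′ (selects-once e e′)
    pigeon : SelectedBy a₁ a₂ (vtxᶜ j s₁) → SelectedBy a₁ a₂ (vtxᶜ j s₂) →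
      SelectedBy a₁ a₂ (vtxᶜ j s₃) → ⊥
    pigeon (inj₁ x) (inj₁ y) _ = twice s₁≢s₂ x y
    pigeon (inj₂ x) (inj₂ y) _ = twice s₁≢s₂ x y
    pigeon (inj₁ x) (inj₂ y) (inj₁ z) = twice s₁≢s₃ x z
    pigeon (inj₁ x) (inj₂ y) (inj₂ z) = twice s₂≢s₃ y z
    pigeon (inj₂ x) (inj₁ y) (inj₁ z) = twice s₂≢s₃ y z
    pigeon (inj₂ x) (inj₁ y) (inj₂ z) = twice s₁≢s₃ x z

  no112 : ∀ α → ¬ Has112 (classCounts α)
  no112 α (i , j , k , i≢j , i≢k , j≢k , 1≤i , 1≤j , 2≤k)
    with count≥1⇒witness _ 1≤i | count≥1⇒witness _ 1≤j | count≥2⇒witnesses _ 2≤k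
  ... | r , er | s , es | u₁ , u₂ , u₁≢u₂ , e₁ , e₂ =
    by-selector u₁ e₁ λ c₁ → by-selector u₂ e₂ λ c₂ → removed a b i≢j cab λ ab → finish c₁ c₂ ab
    where
    a b : Vertexᶜ n
    a = vtxᶜ i r
    b = vtxᶜ j s
    cab : colour a ≡ colour b
    cab = trans (coloured-α a er) (sym (coloured-α b es))
    by-selector : ∀ u → does (colour (vtxᶜ k u) ≟ᶠ α) ≡ true → ¬ ¬ SelectedBy a b (vtxᶜ k u)
    by-selector u f = selected-by-one a b (vtxᶜ k u) (i≢j ∘ cong clsᶜ) i≢k j≢k
      (trans (coloured-α a er) (sym (coloured-α _ f))) (trans (coloured-α b es) (sym (coloured-α _ f)))
    twice : ∀ {x} → select x ≡ just (vtxᶜ k u₁) → select x ≡ just (vtxᶜ k u₂) → ⊥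
    twice e e′ = vtxᶜ-≢ u₁≢u₂ (selects-once e e′)
    finish : SelectedBy a b (vtxᶜ k u₁) → SelectedBy a b (vtxᶜ k u₂) → Removedᶜ select a b → ⊥
    finish (inj₁ x) (inj₁ y) _ = twice x y
    finish (inj₂ x) (inj₂ y) _ = twice x y
    finish (inj₁ x) (inj₂ y) (inj₁ a→b) = j≢k (sym (cong clsᶜ (selects-once x a→b)))
    finish (inj₁ x) (inj₂ y) (inj₂ b→a) = i≢k (sym (cong clsᶜ (selects-once y b→a)))
    finish (inj₂ x) (inj₁ y) (inj₁ a→b) = j≢k (sym (cong clsᶜ (selects-once y a→b)))
    finish (inj₂ x) (inj₁ y) (inj₂ b→a) = i≢k (sym (cong clsᶜ (selects-once x b→a)))

  no1111 : ∀ α → ¬ Has1111 (classCounts α)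
  no1111 α (i , j , k , l , (i≢j , i≢k , i≢l , j≢k , j≢l , k≢l) , (1≤i , 1≤j , 1≤k , 1≤l))
    with count≥1⇒witness _ 1≤i | count≥1⇒witness _ 1≤j | count≥1⇒witness _ 1≤k | count≥1⇒witness _ 1≤l
  ... | r₁ , e₁ | r₂ , e₂ | r₃ , e₃ | r₄ , e₄ =
    selected-by-one a b d (i≢j ∘ cong clsᶜ) i≢l j≢l ca cb λ ab →
    selected-by-one a c d (i≢k ∘ cong clsᶜ) i≢l k≢l ca cc λ ac →
    selected-by-one b c d (j≢k ∘ cong clsᶜ) j≢l k≢l cb cc λ bc → finish ab ac bc
    where
    a b c d : Vertexᶜ n
    a = vtxᶜ i r₁
    b = vtxᶜ j r₂
    c = vtxᶜ k r₃
    d = vtxᶜ l r₄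
    ca : colour a ≡ colour d
    ca = trans (coloured-α a e₁) (sym (coloured-α d e₄))
    cb : colour b ≡ colour d
    cb = trans (coloured-α b e₂) (sym (coloured-α d e₄))
    cc : colour c ≡ colour d
    cc = trans (coloured-α c e₃) (sym (coloured-α d e₄))
    a-b : select a ≡ just d → select b ≡ just d → ⊥
    a-b a→d b→d = no-common-target a b d i≢j (trans ca (sym cb)) a→d b→d (≢-sym i≢l) (≢-sym j≢l)
    a-c : select a ≡ just d → select c ≡ just d → ⊥
    a-c a→d c→d = no-common-target a c d i≢k (trans ca (sym cc)) a→d c→d (≢-sym i≢l) (≢-sym k≢l)
    b-c : select b ≡ just d → select c ≡ just d → ⊥
    b-c b→d c→d = no-common-target b c d j≢k (trans cb (sym cc)) b→d c→d (≢-sym j≢l) (≢-sym k≢l)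
    finish : SelectedBy a b d → SelectedBy a c d → SelectedBy b c d → ⊥
    finish (inj₁ x) (inj₁ y) (inj₁ z) = a-b x z
    finish (inj₁ x) (inj₁ y) (inj₂ z) = a-c x z
    finish (inj₁ x) (inj₂ y) _ = a-c x y
    finish (inj₂ x) (inj₁ y) _ = a-b y x
    finish (inj₂ x) (inj₂ y) _ = b-c x y

  decomposition : Decomposition n m
  decomposition = decomposition-from-sum n classCounts (λ α → no23 α , no112 α , no1111 α)
    (λ i → sym (sum-count (λ ρ → colour (vtxᶜ i ρ))))

decomposition-from-colouring : ∀ {t} {n : Counts t} {m} → Colouring n m → Decomposition n m
decomposition-from-colouring = ColourClasses.decomposition

any-below? : ∀ t (n : Counts t) {P : Counts t → Set} → (∀ {B B′} → B ≗ B′ → P B → P B′) →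
  Decidable P → Dec (Σ (Counts t) λ B → B ≤ᶜ n × P B)
any-below? zero n resp P? with P? (λ ())
... | yes PB = yes ((λ ()) , (λ ()) , PB)
... | no ¬PB = no λ { (B , _ , PB) → ¬PB (resp (λ ()) PB) }
any-below? (suc t) n {P} resp P?
  with anyUpTo? (λ b → any-below? t (tail n) (λ B≗B′ → resp (λ { zero → refl ; (suc i) → B≗B′ i }))
                                             (λ B → P? (b ∷ᶜ B))) (suc (n zero))
... | yes (b , s≤s b≤n₀ , B , B≤n , PB) = yes (b ∷ᶜ B , (λ { zero → b≤n₀ ; (suc i) → B≤n i }) , PB)
... | no none = no λ { (B , B≤n , PB) →
        none (B zero , s≤s (B≤n zero) , tail B , B≤n ∘ suc , resp (λ { zero → refl ; (suc i) → refl }) PB) }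

module _ {t : ℕ} where

  admissible? : Decidable (Admissible {t})
  admissible? v =
    ¬? (any? λ i → any? λ j → ¬? (i ≟ᶠ j) ×-dec 2 ≤? v i ×-dec 3 ≤? v j) ×-dec
    ¬? (any? λ i → any? λ j → any? λ k →
          ¬? (i ≟ᶠ j) ×-dec ¬? (i ≟ᶠ k) ×-dec ¬? (j ≟ᶠ k) ×-dec
          1 ≤? v i ×-dec 1 ≤? v j ×-dec 2 ≤? v k) ×-dec
    ¬? (any? λ i → any? λ j → any? λ k → any? λ l →
          (¬? (i ≟ᶠ j) ×-dec ¬? (i ≟ᶠ k) ×-dec ¬? (i ≟ᶠ l) ×-dec
           ¬? (j ≟ᶠ k) ×-dec ¬? (j ≟ᶠ l) ×-dec ¬? (k ≟ᶠ l)) ×-dec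
          (1 ≤? v i ×-dec 1 ≤? v j ×-dec 1 ≤? v k ×-dec 1 ≤? v l))


  decomposition? : ∀ m (n : Counts t) → Dec (Decomposition n m)
  decomposition? zero n with all? (λ i → n i ≟ 0)
  ... | yes null = yes (done null)
  ... | no ¬null = no λ { (done null) → ¬null null }
  decomposition? (suc m) n
    with any-below? t n
           (λ B≗B′ (adm , d) → admissible-resp (sym ∘ B≗B′) adm , decomposition-resp (cong (n _ ∸_) ∘ B≗B′) d)
           (λ B → admissible? B ×-dec decomposition? m (n ∸ᶜ B))
  ... | yes (B , B≤n , adm , d) = yes (block B B≤n adm d)
  ... | no none = no λ { (block B B≤n adm d) → none (B , B≤n , adm , d) }

module _ (ns : List ℕ) where

  toVertexᶜ : Vertex ns → Vertexᶜ (lookup ns)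
  toVertexᶜ v = vtxᶜ (cls v) (pos v)

  fromVertexᶜ : Vertexᶜ (lookup ns) → Vertex ns
  fromVertexᶜ u = vtx (clsᶜ u) (posᶜ u)

  robust-from-colouring : ∀ {m} → Colouring (lookup ns) m → Robust1Colorable ns m
  robust-from-colouring {m} coloured = f , colour ∘ toVertexᶜ , proper′
    where
    open Colouring coloured
    valid′ : ∀ v w → mapMaybe fromVertexᶜ (select (toVertexᶜ v)) ≡ just w → Adj v w
    valid′ v w e with select (toVertexᶜ v) in selected
    valid′ v w refl | just u = select-valid (toVertexᶜ v) u selected
    valid′ v w () | nothing
    f : OneSelection ns
    f = record { sel = mapMaybe fromVertexᶜ ∘ select ∘ toVertexᶜ ; valid = valid′ }
    proper′ : ProperColoring f m (colour ∘ toVertexᶜ)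
    proper′ u w (adj , not-removed) = proper (toVertexᶜ u) (toVertexᶜ w) adj λ where
      (inj₁ e) → not-removed (inj₁ (cong (mapMaybe fromVertexᶜ) e))
      (inj₂ e) → not-removed (inj₂ (cong (mapMaybe fromVertexᶜ) e))

  colouring-from-robust : ∀ {m} → Robust1Colorable ns m → Colouring (lookup ns) m
  colouring-from-robust (f , c , properly) = record
    { select = mapMaybe toVertexᶜ ∘ sel f ∘ fromVertexᶜ
    ; select-valid = valid′
    ; colour = c ∘ fromVertexᶜ
    ; proper = λ u w adj not-removed → properly (fromVertexᶜ u) (fromVertexᶜ w) (adj , λ where
        (inj₁ e) → not-removed (inj₁ (cong (mapMaybe toVertexᶜ) e))
        (inj₂ e) → not-removed (inj₂ (cong (mapMaybe toVertexᶜ) e)))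
    }
    where
    valid′ : ∀ u w → mapMaybe toVertexᶜ (sel f (fromVertexᶜ u)) ≡ just w → clsᶜ u ≢ clsᶜ w
    valid′ u w e with sel f (fromVertexᶜ u) in selected
    valid′ u w refl | just w′ = valid f (fromVertexᶜ u) w′ selected
    valid′ u w () | nothing

colouring-by-class : ∀ {t} {n : Counts t} → Colouring n t
colouring-by-class = record
  { select = const nothing ; select-valid = λ _ _ () ; colour = clsᶜ ; proper = λ _ _ cu≢cw _ → cu≢cw }

module Snoc (nₜ : ℕ) where

  snoc : List ℕ → List ℕ
  snoc ms = ms ++ nₜ ∷ []

  inject : (ms : List ℕ) → Fin (length ms) → Fin (length (snoc ms))
  inject (_ ∷ ms) zero = zero
  inject (_ ∷ ms) (suc j) = suc (inject ms j)

  last : (ms : List ℕ) → Fin (length (snoc ms))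
  last [] = zero
  last (_ ∷ ms) = suc (last ms)

  lookup-inject : ∀ ms j → lookup (snoc ms) (inject ms j) ≡ lookup ms j
  lookup-inject (_ ∷ ms) zero = refl
  lookup-inject (_ ∷ ms) (suc j) = lookup-inject ms j

  lookup-last : ∀ ms → lookup (snoc ms) (last ms) ≡ nₜ
  lookup-last [] = refl
  lookup-last (_ ∷ ms) = lookup-last ms

  toℕ-last : ∀ ms → toℕ (last ms) ≡ length ms
  toℕ-last [] = refl
  toℕ-last (_ ∷ ms) = cong suc (toℕ-last ms)

  inject≢last : ∀ ms j → inject ms j ≢ last ms
  inject≢last (_ ∷ ms) zero ()
  inject≢last (_ ∷ ms) (suc j) e = inject≢last ms j (suc-injective e)

  inject-injective : ∀ ms {a b} → inject ms a ≡ inject ms b → a ≡ b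
  inject-injective (_ ∷ ms) {zero} {zero} e = refl
  inject-injective (_ ∷ ms) {suc a} {suc b} e = cong suc (inject-injective ms (suc-injective e))

  last-or-inject : ∀ ms (x : Fin (length (snoc ms))) → x ≡ last ms ⊎ Σ (Fin (length ms)) λ j → x ≡ inject ms j
  last-or-inject [] zero = inj₁ refl
  last-or-inject (_ ∷ ms) zero = inj₂ (zero , refl)
  last-or-inject (_ ∷ ms) (suc x) with last-or-inject ms x
  ... | inj₁ e = inj₁ (cong suc e)
  ... | inj₂ (j , e) = inj₂ (suc j , cong suc e)

  pad : ∀ ms → Counts (length ms) → Counts (length (snoc ms))
  pad [] h zero = 0
  pad (_ ∷ ms) h zero = h zero
  pad (_ ∷ ms) h (suc y) = pad ms (h ∘ suc) y

  pad-inject : ∀ ms h j → pad ms h (inject ms j) ≡ h j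
  pad-inject (_ ∷ ms) h zero = refl
  pad-inject (_ ∷ ms) h (suc j) = pad-inject ms (h ∘ suc) j

  pad-last : ∀ ms h → pad ms h (last ms) ≡ 0
  pad-last [] h = refl
  pad-last (_ ∷ ms) h = pad-last ms (h ∘ suc)

module Extension {s t : ℕ} (σ : Fin s → Fin t) (q : Fin t)
  (q-or-σ : ∀ x → x ≡ q ⊎ Σ (Fin s) λ y → x ≡ σ y)
  (ext : Counts s → Counts t) (ext-σ : ∀ g y → ext g (σ y) ≡ g y) (ext-q : ∀ g → ext g q ≡ 0) where

  preimage : ∀ g x {k} → 1 ≤ k → k ≤ ext g x → Σ (Fin s) λ y → x ≡ σ y × k ≤ g y
  preimage g x 1≤k k≤ with q-or-σ x
  ... | inj₁ refl = ⊥-elim (m<n⇒n≢0 (≤-trans 1≤k k≤) (ext-q g))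
  ... | inj₂ (y , refl) = y , refl , subst (_ ≤_) (ext-σ g y) k≤

  preimage-≢ : ∀ {x x′ y y′} → x ≢ x′ → x ≡ σ y → x′ ≡ σ y′ → y ≢ y′
  preimage-≢ x≢x′ refl refl refl = x≢x′ refl

  admissible-ext : ∀ {g} → Admissible g → Admissible (ext g)
  admissible-ext {g} (¬23 , ¬112 , ¬1111) =
    (λ { (i , j , i≢j , 2≤ , 3≤) → case preimage g i 1≤2 2≤ , preimage g j 1≤3 3≤ of λ where
           ((yi , ei , gi) , (yj , ej , gj)) → ¬23 (yi , yj , preimage-≢ i≢j ei ej , gi , gj) }) ,
    (λ { (i , j , k , d₁ , d₂ , d₃ , 1≤i , 1≤j , 2≤k) →
           case preimage g i ≤-refl 1≤i , preimage g j ≤-refl 1≤j , preimage g k 1≤2 2≤k of λ where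
           ((yi , ei , gi) , (yj , ej , gj) , (yk , ek , gk)) →
             ¬112 (yi , yj , yk , preimage-≢ d₁ ei ej , preimage-≢ d₂ ei ek , preimage-≢ d₃ ej ek ,
                   gi , gj , gk) }) ,
    (λ { (i , j , k , l , (d₁ , d₂ , d₃ , d₄ , d₅ , d₆) , (1≤i , 1≤j , 1≤k , 1≤l)) →
           case preimage g i ≤-refl 1≤i , preimage g j ≤-refl 1≤j ,
                preimage g k ≤-refl 1≤k , preimage g l ≤-refl 1≤l of λ where
           ((yi , ei , gi) , (yj , ej , gj) , (yk , ek , gk) , (yl , el , gl)) →
             ¬1111 (yi , yj , yk , yl ,
                    (preimage-≢ d₁ ei ej , preimage-≢ d₂ ei ek , preimage-≢ d₃ ei el ,
                     preimage-≢ d₄ ej ek , preimage-≢ d₅ ej el , preimage-≢ d₆ ek el) , (gi , gj , gk , gl)) })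
    where
    1≤2 : 1 ≤ 2
    1≤2 = s≤s z≤n
    1≤3 : 1 ≤ 3
    1≤3 = s≤s z≤n

  ext-pointwise : ∀ (R : ℕ → ℕ → Set) (g h : Counts s) → (∀ y → R (g y) (h y)) → R 0 0 →
    ∀ x → R (ext g x) (ext h x)
  ext-pointwise R g h R-gh R00 x with q-or-σ x
  ... | inj₁ refl = subst₂ R (sym (ext-q g)) (sym (ext-q h)) R00
  ... | inj₂ (y , refl) = subst₂ R (sym (ext-σ g y)) (sym (ext-σ h y)) (R-gh y)

  decomposition-ext : ∀ {g : Counts s} {m} → Decomposition g m → Decomposition (ext g) m
  decomposition-ext {g} (done null) = done (ext-pointwise (λ a _ → a ≡ 0) g g null refl)
  decomposition-ext {g} (block B B≤g adm d) =
    block (ext B) (ext-pointwise _≤_ B g B≤g z≤n) (admissible-ext adm)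
      (decomposition-resp ext-∸ (decomposition-ext d))
    where
    ext-∸ : ∀ x → ext (g ∸ᶜ B) x ≡ ext g x ∸ ext B x
    ext-∸ x with q-or-σ x
    ... | inj₁ refl = trans (ext-q (g ∸ᶜ B)) (sym (cong₂ _∸_ (ext-q g) (ext-q B)))
    ... | inj₂ (y , refl) = trans (ext-σ (g ∸ᶜ B) y) (sym (cong₂ _∸_ (ext-σ g y) (ext-σ B y)))

Linked-tail : ∀ {x : ℕ} {ys} → Linked _≤_ (x ∷ ys) → Linked _≤_ ys
Linked-tail [-] = []
Linked-tail (_ ∷ sorted) = sorted

head-minimum : ∀ a xs → Linked _≤_ (a ∷ xs) → ∀ i → a ≤ lookup (a ∷ xs) i
head-minimum a xs sorted zero = ≤-refl
head-minimum a (y ∷ ys) (a≤y ∷ sorted) (suc i) = ≤-trans a≤y (head-minimum y ys sorted i)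

last-maximum : ∀ xs b → Linked _≤_ (xs ++ b ∷ []) → ∀ i → lookup (xs ++ b ∷ []) i ≤ b
last-maximum [] b sorted zero = ≤-refl
last-maximum (x ∷ []) b (x≤b ∷ [-]) zero = x≤b
last-maximum (x ∷ y ∷ ys) b (x≤y ∷ sorted) zero = ≤-trans x≤y (last-maximum (y ∷ ys) b sorted zero)
last-maximum (x ∷ xs) b sorted (suc i) = last-maximum xs b (Linked-tail sorted) i

module Theorem (n₁ : ℕ) (ms : List ℕ) (nₜ : ℕ) (sorted : Linked _≤_ (n₁ ∷ ms ++ nₜ ∷ []))
  (1≤n₁ : 1 ≤ n₁) (3≤nₜ : 3 ≤ nₜ) where

  open Snoc nₜ

  big small : List ℕ
  big = n₁ ∷ snoc ms
  small = (n₁ ∸ 1) ∷ ms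

  nB : Counts (length big)
  nB = lookup big

  nS : Counts (length small)
  nS = lookup small

  q : Fin (length big)
  q = suc (last ms)

  ι : Fin (length small) → Fin (length big)
  ι zero = zero
  ι (suc j) = suc (inject ms j)

  ι-injective : ∀ {a b} → ι a ≡ ι b → a ≡ b
  ι-injective {zero} {zero} _ = refl
  ι-injective {suc a} {suc b} e = cong suc (inject-injective ms (suc-injective e))

  ι≢q : ∀ y → ι y ≢ q
  ι≢q (suc j) e = inject≢last ms j (suc-injective e)

  ext : Counts (length small) → Counts (length big)
  ext g zero = g zero
  ext g (suc x) = pad ms (g ∘ suc) x

  ext-ι : ∀ g y → ext g (ι y) ≡ g y
  ext-ι g zero = refl
  ext-ι g (suc j) = pad-inject ms (g ∘ suc) j

  q-or-ι : ∀ x → x ≡ q ⊎ Σ (Fin (length small)) λ y → x ≡ ι y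
  q-or-ι zero = inj₂ (zero , refl)
  q-or-ι (suc x) with last-or-inject ms x
  ... | inj₁ e = inj₁ (cong suc e)
  ... | inj₂ (j , e) = inj₂ (suc j , cong suc e)

  open Extension ι q q-or-ι ext ext-ι (λ g → pad-last ms (g ∘ suc))

  nB-q : nB q ≡ nₜ
  nB-q = lookup-last ms

  first : Fin (length big)
  first = zero

  first≢q : first ≢ q
  first≢q ()

  least-small : ∃[ k ] Decomposition nS k × (∀ {m} → Decomposition nS m → k ≤ m)
  least-small = least (λ m → decomposition? m nS) (decomposition-from-colouring colouring-by-class)

  k : ℕ
  k = proj₁ least-small

  small-decomposition : Decomposition nS k
  small-decomposition = proj₁ (proj₂ least-small)

  k-least : ∀ {m} → Decomposition nS m → k ≤ m
  k-least = proj₂ (proj₂ least-small)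

  χ₁-small : IsChi1 small k
  χ₁-small = robust-from-colouring small (colouring-from-decomposition small-decomposition) ,
    λ m robust → k-least (decomposition-from-colouring (colouring-from-robust small robust))

  T : Counts (length big)
  T = set (δ first) q nₜ

  T-q : T q ≡ nₜ
  T-q = set-≡ (δ first) q nₜ

  T-≢q : ∀ {x} → x ≢ q → T x ≡ δ first x
  T-≢q = set-≢ (δ first) q nₜ

  T-first : T first ≡ 1
  T-first = trans (T-≢q first≢q) (δ-≡ first)

  T≤nB : T ≤ᶜ nB
  T≤nB x = caseFin x q (λ { refl → ≤-rewrite T-q nB-q ≤-refl })
    (λ x≢q → caseFin x first (λ { refl → ≤-rewrite T-first refl 1≤n₁ })
      (λ x≢first → ≤-rewrite (trans (T-≢q x≢q) (δ-≢ first x≢first)) refl z≤n))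

  admissible-T : Admissible T
  admissible-T = admissible-star first q (≤-reflexive T-first)
    (λ x x≢first x≢q → trans (T-≢q x≢q) (δ-≢ first x≢first))

  ext-nS≗nB∸T : ∀ x → ext nS x ≡ nB x ∸ T x
  ext-nS≗nB∸T x with q-or-ι x
  ... | inj₁ refl = trans (pad-last ms (nS ∘ suc)) (sym (trans (cong₂ _∸_ nB-q T-q) (n∸n≡0 nₜ)))
  ... | inj₂ (zero , refl) = cong (n₁ ∸_) (sym T-first)
  ... | inj₂ (suc j , refl) = trans (ext-ι nS (suc j))
          (sym (cong₂ _∸_ (lookup-inject ms j) (trans (T-≢q (ι≢q (suc j))) (δ-≢ first {ι (suc j)} (λ ())))))

  rest-colouring : Colouring (nB ∸ᶜ T) k
  rest-colouring =
    colouring-from-decomposition (decomposition-resp ext-nS≗nB∸T (decomposition-ext small-decomposition))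

  big-colouring : Colouring nB (suc k)
  big-colouring = AddBlock.colouring nB T T≤nB admissible-T rest-colouring

  big-least : ∀ m → Robust1Colorable big m → suc k ≤ m
  big-least m robust = subst (suc k ≤_) (suc[m∸1]≡m 1≤m) (s≤s (k-least reduced-small))
    where
    d : Decomposition nB m
    d = decomposition-from-colouring (colouring-from-robust big robust)
    1≤m : 1 ≤ m
    1≤m = decomposition-nonempty first 1≤n₁ d
    reduced-ι : ∀ y → reduced nB first q (ι y) ≡ nS y
    reduced-ι zero = reduced-p nB first q first≢q
    reduced-ι (suc j) = trans (reduced-other nB first q (λ ()) (ι≢q (suc j))) (lookup-inject ms j)
    reduced-small : Decomposition nS (m ∸ 1)
    reduced-small = decomposition-resp reduced-ι (decomposition-reindex ι ι-injective
      (decomposition-reduced m q nB first first≢q 1≤n₁ (λ j _ → head-minimum n₁ (snoc ms) sorted j)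
        (λ j → subst (nB j ≤_) (sym nB-q) (last-maximum (n₁ ∷ ms) nₜ sorted j))
        (subst (3 ≤_) (sym nB-q) 3≤nₜ) d))

  χ₁-big : IsChi1 big (suc k)
  χ₁-big = robust-from-colouring big big-colouring , big-least

  v₁ : Vertex big
  v₁ = vtx first (fromℕ< 1≤n₁)

  colour : Vertex big → Fin (suc k)
  colour = Colouring.colour big-colouring ∘ toVertexᶜ big

  colour-class : ∀ v → (colour v ≡ zero) ⇔ (toℕ (cls v) ≡ suc (length ms) ⊎ v ≡ v₁)
  colour-class v = mk⇔ (inT⇒ v ∘ to) (from ∘ ⇒inT v)
    where
    open AddBlock nB T T≤nB admissible-T rest-colouring using (colour≡0⇔InB)
    open Equivalence (colour≡0⇔InB (toVertexᶜ big v))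
    toℕ-q : toℕ q ≡ suc (length ms)
    toℕ-q = cong suc (toℕ-last ms)
    inT⇒ : ∀ v → toℕ (pos v) < T (cls v) → toℕ (cls v) ≡ suc (length ms) ⊎ v ≡ v₁
    inT⇒ (vtx i ρ) ρ<Ti = caseFin i q (λ { refl → inj₁ toℕ-q })
      (λ i≢q → caseFin i first
        (λ { refl → inj₂ (cong (vtx first) (toℕ-injective
               (trans (n<1⇒n≡0 (subst (toℕ ρ <_) T-first ρ<Ti)) (sym (toℕ-fromℕ< 1≤n₁))))) })
        (λ i≢first → ⊥-elim (m<n⇒n≢0 (≤-trans (s≤s z≤n) ρ<Ti)
                                       (trans (T-≢q i≢q) (δ-≢ first i≢first)))))
    ⇒inT : ∀ v → toℕ (cls v) ≡ suc (length ms) ⊎ v ≡ v₁ → toℕ (pos v) < T (cls v)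
    ⇒inT (vtx i ρ) (inj₁ e) with toℕ-injective (trans e (sym toℕ-q))
    ... | refl = subst (toℕ ρ <_) (trans nB-q (sym T-q)) (toℕ<n ρ)
    ⇒inT _ (inj₂ refl) = subst₂ _<_ (sym (toℕ-fromℕ< 1≤n₁)) (sym T-first) (s≤s z≤n)

theorem1p5 : (n₁ : ℕ) (ms : List ℕ) (nₜ : ℕ) →
    Linked _≤_ (n₁ ∷ ms ++ nₜ ∷ []) → 1 ≤ n₁ → 3 ≤ nₜ →
    ∃[ k ] (IsChi1 (n₁ ∷ ms ++ nₜ ∷ []) (suc k)
    × IsChi1 ((n₁ ∸ 1) ∷ ms) k
    × Σ (OneSelection (n₁ ∷ ms ++ nₜ ∷ [])) (λ f →
    ∃[ c ] (ProperColoring f (suc k) c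
    × ∃[ a ] ∃[ v₁ ] (cls v₁ ≡ zero
    × (∀ v → (c v ≡ a) ⇔ (toℕ (cls v) ≡ suc (length ms) ⊎ v ≡ v₁))))))
theorem1p5 n₁ ms nₜ sorted 1≤n₁ 3≤nₜ =
  k , χ₁-big , χ₁-small , proj₁ robust , colour , proj₂ (proj₂ robust) , zero , v₁ , refl , colour-class
  where
  open Theorem n₁ ms nₜ sorted 1≤n₁ 3≤nₜ
  robust : Robust1Colorable (n₁ ∷ ms ++ nₜ ∷ []) (suc k)
  robust = proj₁ χ₁-big
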